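{- Let $a,b$ be coprime positive integers and fix $k$ with $0\le k\le b-1$. A chip configuration $D\ge 0$ is $k$-skeletal if and only if $\mathrm{lpath}(D)$ is a $k$-skeletal labeled path.
   Context: Write $[b]=\{1,\dots,b\}$. A chip configuration is $D:[b]\to\mathbb{Z}$; $D\ge0$ means all values nonnegative. For $S\subseteq[b]$ with $|S|=s$, the cluster-fire move $\phi_S$ subtracts $1+\lfloor (b-s)a/b\rfloor$ from $D(i)$ for $i\in S$ and adds $\lfloor sa/b\rfloor$ to $D(j)$ for $j\in[b]\setminus S$; $\beta_S=\phi_S^{ -1}$. For $D\ge0$, $\phi_S$ (resp. $\beta_S$) is legal if $\phi_S(D)\ge 0$ (resp. $\beta_S(D)\ge0$). A $k$-firing move is $\phi_S$ with $0<|S|\le k+1$; $D\ge0$ is $k$-stable if no $k$-firing move is legal on $D$; $D$ is $k$-skeletal if it is $k$-stable and for every nonempty $T$ with $\beta_T$ legal on $D$, $\beta_T(D)$ is not $k$-stable. Labeled path of $D\ge0$: vertex $i$ is poorer than $j$ if $D(i)<D(j)$, or $D(i)=D(j)$ and $i<j$. Let $w_1,\dots,w_b$ be the vertices from poorest to richest and $x_t=D(w_t)$. $\mathrm{lpath}(D)$ is the lattice path starting at $(0,0)$ which has, for each $t$, a north step from $(x_t,t-1)$ to $(x_t,t)$ labeled $w_t$, consecutive north steps being joined by east steps, and which ends with east steps from $(x_b,b)$ to $(a,b)$ if $x_b\le a$ (if $x_b>a$ it ends at $(x_b,b)$). Paths: the level of a lattice point $(x,y)$ is $ay-bx$. For a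 lattice path $Q$ from $(0,0)$ to $(a,b)$ with unit north and east steps and a lattice point $v$ on $Q$, the cyclic shift $Q_v$ is the path from the origin whose steps are those of $Q$ from $v$ to $(a,b)$ followed by those from $(0,0)$ to $v$ (labels move with their north steps). $Q$ is $k$-skeletal if (R1) the last $k+1$ north steps of $Q$ start at points of level $\ge 0$, and (R2) for every lattice point $v$ on $Q$ of level $>0$, (R1) fails for $Q_v$. A labeled path is $k$-skeletal if its underlying unlabeled path is; a path not ending at $(a,b)$ is not $k$-skeletal for any $k$. -}

module Defs where

open import Data.Nat as ℕ using (ℕ; zero; suc; NonZero; _∸_; _≤ᵇ_)
open import Data.Nat.DivMod using (_/_)
open import Data.Integer as ℤ using (ℤ; +_; _-_; _+_; _≤_; _<_)
open import Data.Fin using (Fin; toℕ)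
open import Data.Fin.Subset using (Subset; ∣_∣)
open import Data.Vec using (lookup)
open import Data.Bool using (Bool; true; false; if_then_else_; _∨_; _∧_)
open import Data.List using (List; []; _∷_; _++_; replicate; foldr; length; take; drop; allFin)
open import Data.Product using (_×_; _,_)
open import Relation.Nullary using (¬_)
open import Relation.Nullary.Decidable using (⌊_⌋)
open import Function.Bundles using (_⇔_)

Config : ℕ → Set
Config b = Fin b → ℤ

NonNeg : ∀ {b} → Config b → Set
NonNeg D = ∀ i → + 0 ≤ D i

fire : (a b : ℕ) .{{_ : NonZero b}} → Subset b → Config b → Config b
fire a b S D i =
  if lookup S i
  then D i - (+ (suc (((b ∸ ∣ S ∣) ℕ.* a) / b)))
  else D i + (+ ((∣ S ∣ ℕ.* a) / b))

borrow : (a b : ℕ) .{{_ : NonZero b}} → Subset b → Config b → Config b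
borrow a b S D i =
  if lookup S i
  then D i + (+ (suc (((b ∸ ∣ S ∣) ℕ.* a) / b)))
  else D i - (+ ((∣ S ∣ ℕ.* a) / b))

KStable : (a b : ℕ) .{{_ : NonZero b}} → ℕ → Config b → Set
KStable a b k D =
  NonNeg D × (∀ (S : Subset b) → 0 ℕ.< ∣ S ∣ → ∣ S ∣ ℕ.≤ suc k → ¬ NonNeg (fire a b S D))

KSkeletal : (a b : ℕ) .{{_ : NonZero b}} → ℕ → Config b → Set
KSkeletal a b k D =
  KStable a b k D ×
  (∀ (T : Subset b) → 0 ℕ.< ∣ T ∣ → NonNeg (borrow a b T D) → ¬ KStable a b k (borrow a b T D))

data Step (b : ℕ) : Set where
  E : Step b
  N : Fin b → Step b

Path : ℕ → Set
Path b = List (Step b)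

countE : ∀ {b} → Path b → ℕ
countE [] = 0
countE (E ∷ p) = suc (countE p)
countE (N _ ∷ p) = countE p

countN : ∀ {b} → Path b → ℕ
countN [] = 0
countN (E ∷ p) = countN p
countN (N _ ∷ p) = suc (countN p)

level : (a b : ℕ) → ℕ × ℕ → ℤ
level a b (x , y) = + (a ℕ.* y) - + (b ℕ.* x)

northStarts : ∀ {b} → ℕ × ℕ → Path b → List (ℕ × ℕ)
northStarts p [] = []
northStarts (x , y) (E ∷ q) = northStarts (suc x , y) q
northStarts (x , y) (N _ ∷ q) = (x , y) ∷ northStarts (x , suc y) q

data AllL {A : Set} (P : A → Set) : List A → Set where
  []  : AllL P []
  _∷_ : ∀ {x xs} → P x → AllL P xs → AllL P (x ∷ xs)

lastN : {A : Set} → ℕ → List A → List A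
lastN n xs = drop (length xs ∸ n) xs

R1 : (a b k : ℕ) → Path b → Set
R1 a b k Q = AllL (λ v → + 0 ≤ level a b v) (lastN (suc k) (northStarts (0 , 0) Q))

pointAt : ∀ {b} → ℕ → Path b → ℕ × ℕ
pointAt m Q = (countE (take m Q) , countN (take m Q))

-- cyclic shift Q_v where v is the point after the first m steps
shift : ∀ {b} → ℕ → Path b → Path b
shift m Q = drop m Q ++ take m Q

KSkeletalPath : (a b k : ℕ) → Path b → Set
KSkeletalPath a b k Q =
  (countE Q ≡ a × countN Q ≡ b) ×
  R1 a b k Q ×
  (∀ m → m ℕ.≤ length Q → + 0 < level a b (pointAt m Q) → ¬ R1 a b k (shift m Q))
  where open import Relation.Binary.PropositionalEquality using (_≡_)

poorer : ∀ {b} → Config b → Fin b → Fin b → Bool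
poorer D i j = ⌊ D i ℤ.<? D j ⌋ ∨ (⌊ D i ℤ.≟ D j ⌋ ∧ ⌊ toℕ i ℕ.<? toℕ j ⌋)

insertV : ∀ {b} → Config b → Fin b → List (Fin b) → List (Fin b)
insertV D w [] = w ∷ []
insertV D w (v ∷ vs) = if poorer D w v then w ∷ v ∷ vs else v ∷ insertV D w vs

sortedVerts : ∀ {b} → Config b → List (Fin b)
sortedVerts {b} D = foldr (insertV D) [] (allFin b)

-- values are read as natural numbers via ∣_∣ (D ≥ 0 is assumed wherever used)
lpathFrom : (a : ℕ) → ∀ {b} → Config b → ℕ → List (Fin b) → Path b
lpathFrom a D cur [] = if cur ≤ᵇ a then replicate (a ∸ cur) E else []
lpathFrom a D cur (w ∷ ws) =
  replicate (ℤ.∣ D w ∣ ∸ cur) E ++ (N w ∷ lpathFrom a D ℤ.∣ D w ∣ ws)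

lpath : (a : ℕ) → ∀ {b} → Config b → Path b
lpath a D = lpathFrom a D 0 (sortedVerts D)

{-# OPTIONS --safe #-}
-- Sort the vertices by chip count, x₁ ≤ ⋯ ≤ x_b. The north step of lpath(D) at height t
-- starts at (x_{t+1}, t), of level a t − b x_{t+1}, and firing the s richest vertices is
-- legal exactly when the north step at height b − s starts below level 0; hence D is
-- k-stable iff lpath(D) satisfies (R1). If β_T(D) is stable, each vertex of T gains
-- cost |T| = 1 + ⌊(b − |T|)a/b⌋ chips and still stays below a, while every other vertex
-- affords to lose ⌊|T|a/b⌋, which by coprimality is at least x = a − cost |T|. So T
-- consists of the |T| poorest vertices, all below x, the point (x, |T|) lies on lpath(D)
-- at a level in (0, b], and lpath(β_T D) is the cyclic shift of lpath(D) at that point,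
-- with every level lowered by the level of the point. Conversely each point of lpath(D)
-- of level in (0, b] arises this way. Finally, a point of positive level at which the
-- shift satisfies (R1) can be moved forward along the path to one of level in (0, b]:
-- east steps lower the level by b, and the north steps passed start above level b.
module Submission where

open import Defs
open import Data.Nat as ℕ using (ℕ; zero; suc; _+_; _*_; _∸_; _≤_; _<_; z≤n; s≤s; NonZero; _≤ᵇ_)
open import Data.Nat.Properties
open import Data.Nat.DivMod
open import Data.Nat.Divisibility using (divides; ∣⇒≤)
open import Data.Nat.Coprimality as Coprime using (Coprime; coprime-divisor)
open import Data.Nat.Tactic.RingSolver using (solve-∀)
import Data.Integer.Tactic.RingSolver as ℤ-Solver
open import Data.Integer as ℤ using (ℤ; +_; +≤+; +<+; 0ℤ)
import Data.Integer.Properties as ℤ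
open import Data.Bool using (true; false; if_then_else_)
open import Data.Bool.Properties using (T-≡)
open import Data.Fin using (Fin) renaming (suc to fsuc)
import Data.Fin.Properties as Fin
open import Data.Fin.Subset using (Subset; ∣_∣; ⁅_⁆; ⊤)
open import Data.Fin.Subset.Properties using (∣⊤∣≡n; ∣⁅x⁆∣≡1; x∈⁅x⁆; x∈⁅y⁆⇒x≡y; ∣p∣≤n)
open import Data.Vec as Vec using (lookup)
open import Data.Vec.Properties using (lookup-replicate; []=⇒lookup; lookup⇒[]=; lookup∘tabulate)
open import Data.List using (List; []; _∷_; _++_; length; map; take; drop; replicate; foldr; allFin; tabulate)
open import Data.List.Properties
  using (length-++; length-map; ++-assoc; ++-identityʳ; ∷-injectiveʳ; take++drop≡id; drop-map;
         map-++; map-∘; map-cong; map-cong-local; map-id; map-id-local; map-tabulate)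
open import Data.List.Membership.Propositional using (_∈_; _∉_)
open import Data.List.Membership.Propositional.Properties using (∈-++⁻)
open import Data.List.Relation.Unary.Any using (here; there)
open import Data.List.Relation.Unary.All as All using (All; []; _∷_)
open import Data.List.Relation.Unary.All.Properties as All using (++⁺; ++⁻ˡ; ++⁻ʳ; drop⁺)
open import Data.List.Relation.Unary.AllPairs as AllPairs using (AllPairs; []; _∷_)
import Data.List.Relation.Unary.AllPairs.Properties as AllPairs
open import Data.Product using (_×_; _,_; ∃; ∃₂; proj₁; proj₂)
open import Data.Sum using (inj₁; inj₂)
open import Function using (_∘_; _on_; case_of_)
open import Function.Bundles using (_⇔_; mk⇔; Equivalence)
open import Function.Properties.Equivalence using () renaming (refl to ⇔-refl; sym to ⇔-sym; trans to ⇔-trans)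
open import Relation.Nullary using (does; yes; no; ¬_; contradiction)
open import Relation.Binary.PropositionalEquality

private variable
  A B : Set
  P : A → Set
  xs ys : List A

-- Lists and their last entries

AllL⇔All : AllL P xs ⇔ All P xs
AllL⇔All = mk⇔ to from
  where
  to : ∀ {xs} → AllL P xs → All P xs
  to [] = []
  to (p ∷ ps) = p ∷ to ps
  from : ∀ {xs} → All P xs → AllL P xs
  from [] = []
  from (p ∷ ps) = p ∷ from ps

≡⇒⇔ : ∀ {X Y : Set} → X ≡ Y → X ⇔ Y
≡⇒⇔ refl = ⇔-refl

take-length-++ : ∀ (xs ys : List A) → take (length xs) (xs ++ ys) ≡ xs
take-length-++ [] ys = refl
take-length-++ (x ∷ xs) ys = cong (x ∷_) (take-length-++ xs ys)

drop-+-++ : ∀ k (xs ys : List A) → drop (length xs + k) (xs ++ ys) ≡ drop k ys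
drop-+-++ k [] ys = refl
drop-+-++ k (x ∷ xs) ys = drop-+-++ k xs ys

drop-length-++ : ∀ (xs ys : List A) → drop (length xs) (xs ++ ys) ≡ ys
drop-length-++ xs ys = subst (λ k → drop k (xs ++ ys) ≡ ys) (+-identityʳ (length xs)) (drop-+-++ 0 xs ys)

drop-≤-++ : ∀ k (xs ys : List A) → k ≤ length xs → drop k (xs ++ ys) ≡ drop k xs ++ ys
drop-≤-++ zero xs ys _ = refl
drop-≤-++ (suc k) (x ∷ xs) ys (s≤s k≤) = drop-≤-++ k xs ys k≤

rotate : ℕ → List A → List A
rotate n xs = drop n xs ++ take n xs

rotate-++ : ∀ (xs ys : List A) → rotate (length xs) (xs ++ ys) ≡ ys ++ xs
rotate-++ xs ys = cong₂ _++_ (drop-length-++ xs ys) (take-length-++ xs ys)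

lastN-++-≤ : ∀ n (xs ys : List A) → n ≤ length ys → lastN n (xs ++ ys) ≡ lastN n ys
lastN-++-≤ n xs ys n≤ = begin
  drop (length (xs ++ ys) ∸ n) (xs ++ ys)          ≡⟨ cong (λ l → drop (l ∸ n) (xs ++ ys)) (length-++ xs) ⟩
  drop (length xs + length ys ∸ n) (xs ++ ys)      ≡⟨ cong (λ k → drop k (xs ++ ys)) (+-∸-assoc (length xs) n≤) ⟩
  drop (length xs + (length ys ∸ n)) (xs ++ ys)    ≡⟨ drop-+-++ (length ys ∸ n) xs ys ⟩
  drop (length ys ∸ n) ys                          ∎
  where open ≡-Reasoning

lastN-++-≥ : ∀ n (xs ys : List A) → length ys ≤ n → lastN n (xs ++ ys) ≡ lastN (n ∸ length ys) xs ++ ys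
lastN-++-≥ n xs ys ys≤ = begin
  drop (length (xs ++ ys) ∸ n) (xs ++ ys)   ≡⟨ cong (λ k → drop k (xs ++ ys)) start ⟩
  drop (length xs ∸ r) (xs ++ ys)          ≡⟨ drop-≤-++ (length xs ∸ r) xs ys (m∸n≤m (length xs) r) ⟩
  drop (length xs ∸ r) xs ++ ys            ∎
  where
  open ≡-Reasoning
  r = n ∸ length ys
  start : length (xs ++ ys) ∸ n ≡ length xs ∸ r
  start = begin
    length (xs ++ ys) ∸ n                   ≡⟨ cong₂ _∸_ (length-++ xs) (sym (m+[n∸m]≡n ys≤)) ⟩
    length xs + length ys ∸ (length ys + r) ≡⟨ cong (_∸ (length ys + r)) (+-comm (length xs) (length ys)) ⟩
    length ys + length xs ∸ (length ys + r) ≡⟨ [m+n]∸[m+o]≡n∸o (length ys) (length xs) r ⟩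
    length xs ∸ r                           ∎

lastN-all : ∀ n (xs : List A) → length xs ≤ n → lastN n xs ≡ xs
lastN-all n xs xs≤ = cong (λ k → drop k xs) (m≤n⇒m∸n≡0 xs≤)

All-lastN-++⁻ʳ : ∀ n (xs : List A) {ys} → All P (lastN n (xs ++ ys)) → All P (lastN n ys)
All-lastN-++⁻ʳ n xs {ys} h with ≤-total n (length ys)
... | inj₁ n≤ = subst (All _) (lastN-++-≤ n xs ys n≤) h
... | inj₂ ys≤ =
  drop⁺ (length ys ∸ n) (++⁻ʳ (lastN (n ∸ length ys) xs) (subst (All _) (lastN-++-≥ n xs ys ys≤) h))

All-lastN-∷⁻ : ∀ {n} (xs : List A) {z} ys → All P (lastN n (xs ++ z ∷ ys)) → length ys < n → P z
All-lastN-∷⁻ {n = n} xs {z} ys h ys< =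
  All.head (++⁻ʳ (lastN (n ∸ suc (length ys)) xs) (subst (All _) (lastN-++-≥ n xs (z ∷ ys) ys<) h))

All-lastN-∷⁺ : ∀ n (xs : List A) →
  (∀ ys z zs → xs ≡ ys ++ z ∷ zs → length zs < n → P z) → All P (lastN n xs)
All-lastN-∷⁺ n [] f = subst (All _) (sym (lastN-all n [] z≤n)) []
All-lastN-∷⁺ n (x ∷ xs) f
  with All-lastN-∷⁺ n xs (λ ys z zs eq → f (x ∷ ys) z zs (cong (x ∷_) eq)) | n ℕ.≤? length xs
... | rest | yes n≤ = subst (All _) (sym (lastN-++-≤ n (x ∷ []) xs n≤)) rest
... | rest | no n≰ = subst (All _) (sym (lastN-all n (x ∷ xs) (≰⇒> n≰)))
  (f [] x xs refl (≰⇒> n≰) ∷ subst (All _) (lastN-all n xs (<⇒≤ (≰⇒> n≰))) rest)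

All-lastN-mono : ∀ {m n} (xs : List A) → m ≤ n → All P (lastN n xs) → All P (lastN m xs)
All-lastN-mono {m = m} {n} xs m≤n h = All-lastN-∷⁺ m xs λ ys z zs eq zs< →
  All-lastN-∷⁻ ys zs (subst (λ l → All _ (lastN n l)) eq h) (<-≤-trans zs< m≤n)

All-lastN-rotate : ∀ n (zs xs ys : List A) → All P zs →
  All P (lastN n (zs ++ xs ++ ys)) → All P (lastN n (xs ++ ys ++ zs))
All-lastN-rotate n zs xs ys pzs h rewrite sym (++-assoc xs ys zs) with ≤-total n (length zs)
... | inj₁ n≤ = subst (All _) (sym (lastN-++-≤ n (xs ++ ys) zs n≤)) (drop⁺ (length zs ∸ n) pzs)
... | inj₂ zs≤ = subst (All _) (sym (lastN-++-≥ n (xs ++ ys) zs zs≤))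
  (++⁺ (All-lastN-mono (xs ++ ys) (m∸n≤m n (length zs)) (All-lastN-++⁻ʳ n zs h)) pzs)

lastN-map : ∀ n (f : A → B) xs → lastN n (map f xs) ≡ map f (lastN n xs)
lastN-map n f xs rewrite length-map f xs = drop-map (length xs ∸ n) xs

All-lastN-map⇔ : ∀ {P : B → Set} n (f : A → B) xs → All P (lastN n (map f xs)) ⇔ All (P ∘ f) (lastN n xs)
All-lastN-map⇔ n f xs =
  mk⇔ (All.map⁻ ∘ subst (All _) (lastN-map n f xs)) (subst (All _) (sym (lastN-map n f xs)) ∘ All.map⁺)

map-+-− : ∀ l zs → map (ℤ._- l) (map (ℤ._+ l) zs) ≡ zs
map-+-− l zs = trans (sym (map-∘ zs)) (trans (map-cong (λ z → [z+l]-l≡z z l) zs) (map-id zs))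
  where
  [z+l]-l≡z : ∀ z l → z ℤ.+ l ℤ.- l ≡ z
  [z+l]-l≡z = ℤ-Solver.solve-∀

TailAbove : ℕ → ℤ → List ℤ → Set
TailAbove k L zs = All (L ℤ.≤_) (lastN (suc k) zs)

tailAbove-shift⇔ : ∀ k L zs → TailAbove k (+ 0) (map (ℤ._- L) zs) ⇔ TailAbove k L zs
tailAbove-shift⇔ k L zs = ⇔-trans (All-lastN-map⇔ (suc k) (ℤ._- L) zs)
  (mk⇔ (All.map ℤ.0≤i-j⇒j≤i) (All.map ℤ.i≤j⇒0≤j-i))

split-at : ∀ {j} (xs : List A) → j < length xs → ∃₂ λ P B → ∃ λ x → xs ≡ P ++ x ∷ B × length P ≡ j
split-at {j = zero} (x ∷ xs) _ = [] , xs , x , refl , refl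
split-at {j = suc j} (x ∷ xs) (s≤s j<) with split-at xs j<
... | P , B , y , xs≡ , len = x ∷ P , B , y , cong (x ∷_) xs≡ , cong suc len

∈⇒0<length : ∀ {X : Set} {x : X} {xs} → x ∈ xs → 0 < length xs
∈⇒0<length (here _) = s≤s z≤n
∈⇒0<length (there _) = s≤s z≤n

module _ {R : A → A → Set} where

  AllPairs-++⁻ : ∀ (xs : List A) {ys} → AllPairs R (xs ++ ys) →
    AllPairs R xs × AllPairs R ys × All (λ x → All (R x) ys) xs
  AllPairs-++⁻ [] sorted = [] , sorted , []
  AllPairs-++⁻ (x ∷ xs) (x≺ ∷ sorted) with AllPairs-++⁻ xs sorted
  ... | sxs , sys , cross = ++⁻ˡ xs x≺ ∷ sxs , sys , ++⁻ʳ xs x≺ ∷ cross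

-- Enumerations of the vertices

module _ {n : ℕ} where

  open import Data.List.Membership.DecPropositional (Fin._≟_ {n}) using (_∈?_)

  count : Subset n → List (Fin n) → ℕ
  count S [] = 0
  count S (i ∷ is) = if lookup S i then suc (count S is) else count S is

  -- Counting every subset correctly characterises the lists containing each vertex exactly once.
  IsEnumeration : List (Fin n) → Set
  IsEnumeration ws = ∀ S → count S ws ≡ ∣ S ∣

  count-++ : ∀ S (xs ys : List (Fin n)) → count S (xs ++ ys) ≡ count S xs + count S ys
  count-++ S [] ys = refl
  count-++ S (x ∷ xs) ys with lookup S x
  ... | true = cong suc (count-++ S xs ys)
  ... | false = count-++ S xs ys

  count≤length : ∀ S (xs : List (Fin n)) → count S xs ≤ length xs
  count≤length S [] = z≤n
  count≤length S (x ∷ xs) with lookup S x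
  ... | true = s≤s (count≤length S xs)
  ... | false = m≤n⇒m≤1+n (count≤length S xs)

  count-outside : ∀ {S} {xs : List (Fin n)} → All (λ i → lookup S i ≡ false) xs → count S xs ≡ 0
  count-outside [] = refl
  count-outside (out ∷ outs) rewrite out = count-outside outs

  count-inside : ∀ {S} {xs : List (Fin n)} → All (λ i → lookup S i ≡ true) xs → count S xs ≡ length xs
  count-inside [] = refl
  count-inside (in′ ∷ ins) rewrite in′ = cong suc (count-inside ins)

  count-∈ : ∀ {S i} {xs : List (Fin n)} → i ∈ xs → lookup S i ≡ true → 0 < count S xs
  count-∈ (here refl) inS rewrite inS = s≤s z≤n
  count-∈ {S} {xs = x ∷ xs} (there i∈) inS with lookup S x
  ... | true = s≤s z≤n
  ... | false = count-∈ i∈ inS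

  count-⁅⁆⇒∈ : ∀ {i} {xs : List (Fin n)} → 0 < count ⁅ i ⁆ xs → i ∈ xs
  count-⁅⁆⇒∈ {i} {x ∷ xs} pos with lookup ⁅ i ⁆ x in eq
  ... | true = here (sym (x∈⁅y⁆⇒x≡y i (lookup⇒[]= x ⁅ i ⁆ eq)))
  ... | false = there (count-⁅⁆⇒∈ pos)

  count-split : ∀ S xs {ys} → IsEnumeration (xs ++ ys) → All (λ i → lookup S i ≡ true) xs →
    All (λ i → lookup S i ≡ false) ys → ∣ S ∣ ≡ length xs
  count-split S xs {ys} enum ins outs = begin
    ∣ S ∣                           ≡⟨ enum S ⟨
    count S (xs ++ ys)              ≡⟨ count-++ S xs ys ⟩
    count S xs + count S ys         ≡⟨ cong₂ _+_ (count-inside ins) (count-outside outs) ⟩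
    length xs + 0                   ≡⟨ +-identityʳ (length xs) ⟩
    length xs                       ∎
    where open ≡-Reasoning

  enumeration-length : ∀ xs → IsEnumeration xs → length xs ≡ n
  enumeration-length xs enum = begin
    length xs     ≡⟨ count-inside (All.universal (λ i → lookup-replicate i true) xs) ⟨
    count ⊤ xs    ≡⟨ enum ⊤ ⟩
    ∣ ⊤ {n} ∣     ≡⟨ ∣⊤∣≡n n ⟩
    n             ∎
    where open ≡-Reasoning

  enumeration-∈ : ∀ {xs i} → IsEnumeration xs → i ∈ xs
  enumeration-∈ {i = i} enum = count-⁅⁆⇒∈ (≤-reflexive (sym (trans (enum ⁅ i ⁆) (∣⁅x⁆∣≡1 i))))

  enumeration-disjoint : ∀ xs {ys i} → IsEnumeration (xs ++ ys) → i ∈ xs → i ∉ ys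
  enumeration-disjoint xs {ys} {i} enum i∈xs i∈ys = <-irrefl refl (begin-strict
    1                                    <⟨ +-monoʳ-≤ 1 (count-∈ i∈ys i∈⁅i⁆) ⟩
    suc (count ⁅ i ⁆ ys)                 ≤⟨ +-monoˡ-≤ (count ⁅ i ⁆ ys) (count-∈ i∈xs i∈⁅i⁆) ⟩
    count ⁅ i ⁆ xs + count ⁅ i ⁆ ys      ≡⟨ count-++ ⁅ i ⁆ xs ys ⟨
    count ⁅ i ⁆ (xs ++ ys)               ≡⟨ enum ⁅ i ⁆ ⟩
    ∣ ⁅ i ⁆ ∣                            ≡⟨ ∣⁅x⁆∣≡1 i ⟩
    1                                    ∎)
    where
    open ≤-Reasoning
    i∈⁅i⁆ = []=⇒lookup (x∈⁅x⁆ i)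

  enumeration-swap : ∀ xs {ys} → IsEnumeration (xs ++ ys) → IsEnumeration (ys ++ xs)
  enumeration-swap xs {ys} enum S = begin
    count S (ys ++ xs)        ≡⟨ count-++ S ys xs ⟩
    count S ys + count S xs   ≡⟨ +-comm (count S ys) (count S xs) ⟩
    count S xs + count S ys   ≡⟨ count-++ S xs ys ⟨
    count S (xs ++ ys)        ≡⟨ enum S ⟩
    ∣ S ∣                     ∎
    where open ≡-Reasoning

  setOf : List (Fin n) → Subset n
  setOf xs = Vec.tabulate (λ i → does (i ∈? xs))

  setOf-split : ∀ xs {ys} → IsEnumeration (xs ++ ys) →
    All (λ i → lookup (setOf xs) i ≡ true) xs × All (λ i → lookup (setOf xs) i ≡ false) ys
  setOf-split xs {ys} enum = All.tabulate inside , All.tabulate outside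
    where
    inside : ∀ {i} → i ∈ xs → lookup (setOf xs) i ≡ true
    inside {i} i∈xs rewrite lookup∘tabulate (λ i → does (i ∈? xs)) i with i ∈? xs
    ... | yes _ = refl
    ... | no i∉xs = contradiction i∈xs i∉xs
    outside : ∀ {i} → i ∈ ys → lookup (setOf xs) i ≡ false
    outside {i} i∈ys rewrite lookup∘tabulate (λ i → does (i ∈? xs)) i with i ∈? xs
    ... | yes i∈xs = contradiction i∈ys (enumeration-disjoint xs enum i∈xs)
    ... | no _ = refl

count-map-suc : ∀ {n} x (S : Subset n) is → count (x Vec.∷ S) (map fsuc is) ≡ count S is
count-map-suc x S [] = refl
count-map-suc x S (i ∷ is) with lookup S i
... | true = cong suc (count-map-suc x S is)
... | false = count-map-suc x S is

count-allFin : ∀ {n} (S : Subset n) → count S (allFin n) ≡ ∣ S ∣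
count-allFin-suc : ∀ {n} x (S : Subset n) → count (x Vec.∷ S) (tabulate fsuc) ≡ ∣ S ∣

count-allFin {zero} Vec.[] = refl
count-allFin {suc n} (true Vec.∷ S) = cong suc (count-allFin-suc true S)
count-allFin {suc n} (false Vec.∷ S) = count-allFin-suc false S

count-allFin-suc x S = begin
  count (x Vec.∷ S) (tabulate fsuc)            ≡⟨ cong (count (x Vec.∷ S)) (map-tabulate (λ i → i) fsuc) ⟨
  count (x Vec.∷ S) (map fsuc (allFin _))      ≡⟨ count-map-suc x S (allFin _) ⟩
  count S (allFin _)                           ≡⟨ count-allFin S ⟩
  ∣ S ∣                                         ∎
  where open ≡-Reasoning

module _ {b : ℕ} (D : Config b) where

  private
    _≼_ : Fin b → Fin b → Set
    v ≼ w = D v ℤ.≤ D w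

  poorer⇒≤ : ∀ {v w} → poorer D v w ≡ true → v ≼ w
  poorer⇒≤ {v} {w} eq with D v ℤ.<? D w | D v ℤ.≟ D w
  ... | yes v<w | _ = ℤ.<⇒≤ v<w
  ... | no _ | yes v≡w = ℤ.≤-reflexive v≡w

  ¬poorer⇒≥ : ∀ {v w} → poorer D v w ≡ false → w ≼ v
  ¬poorer⇒≥ {v} {w} eq with D v ℤ.<? D w
  ... | no v≮w = ℤ.≮⇒≥ v≮w

  count-insertV : ∀ S w vs → count S (insertV D w vs) ≡ count S (w ∷ vs)
  count-insertV S w [] = refl
  count-insertV S w (v ∷ vs) with poorer D w v
  ... | true = refl
  ... | false with lookup S v | lookup S w | count-insertV S w vs
  ...   | true | true | eq = cong suc eq
  ...   | true | false | eq = cong suc eq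
  ...   | false | true | eq = eq
  ...   | false | false | eq = eq

  sortedVerts-enumeration : IsEnumeration (sortedVerts D)
  sortedVerts-enumeration S = trans (count-foldr (allFin b)) (count-allFin S)
    where
    count-foldr : ∀ ws → count S (foldr (insertV D) [] ws) ≡ count S ws
    count-foldr [] = refl
    count-foldr (w ∷ ws) with lookup S w | count-insertV S w (foldr (insertV D) [] ws)
    ... | true | ins = trans ins (cong suc (count-foldr ws))
    ... | false | ins = trans ins (count-foldr ws)

  All-insertV : ∀ {P : Fin b → Set} {w vs} → P w → All P vs → All P (insertV D w vs)
  All-insertV {w = w} {[]} pw [] = pw ∷ []
  All-insertV {w = w} {v ∷ vs} pw (pv ∷ pvs) with poorer D w v
  ... | true = pw ∷ pv ∷ pvs
  ... | false = pv ∷ All-insertV pw pvs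

  insertV-sorted : ∀ w {vs} → AllPairs _≼_ vs → AllPairs _≼_ (insertV D w vs)
  insertV-sorted w {[]} [] = [] ∷ []
  insertV-sorted w {v ∷ vs} (v≼vs ∷ sorted) with poorer D w v in eq
  ... | true = (w≼v ∷ All.map (ℤ.≤-trans w≼v) v≼vs) ∷ v≼vs ∷ sorted
    where w≼v = poorer⇒≤ eq
  ... | false = All-insertV (¬poorer⇒≥ eq) v≼vs ∷ insertV-sorted w sorted

  sortedVerts-sorted : AllPairs _≼_ (sortedVerts D)
  sortedVerts-sorted = go (allFin b)
    where
    go : ∀ ws → AllPairs _≼_ (foldr (insertV D) [] ws)
    go [] = []
    go (w ∷ ws) = insertV-sorted w (go ws)

-- Arithmetic of levels and costs

data Compare-≤ (k : ℕ) : ℕ → Set where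
  within : ∀ {m} → m ≤ k → Compare-≤ k m
  beyond : ∀ m′ → Compare-≤ k (k + suc m′)

compare-≤ : ∀ m k → Compare-≤ k m
compare-≤ m k with m ≤? k
... | yes m≤k = within m≤k
... | no m≰k = subst (Compare-≤ k) (trans (+-suc k _) (m+[n∸m]≡n (≰⇒> m≰k))) (beyond (m ∸ suc k))

∸-telescope : ∀ {c w x} → c ≤ w → w ≤ x → (w ∸ c) + (x ∸ w) ≡ x ∸ c
∸-telescope {c} {w} {x} c≤w w≤x =
  trans (+-comm (w ∸ c) (x ∸ w)) (trans (sym (+-∸-assoc (x ∸ w) c≤w)) (cong (_∸ c) (m∸n+n≡m w≤x)))

j+[i-j]≡i : ∀ i j → j ℤ.+ (i ℤ.- j) ≡ i
j+[i-j]≡i = ℤ-Solver.solve-∀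

0<i-j⇔j<i : ∀ {i j} → 0ℤ ℤ.< i ℤ.- j ⇔ j ℤ.< i
0<i-j⇔j<i {i} {j} = mk⇔
  (λ 0<i-j → subst₂ ℤ._<_ (ℤ.+-identityʳ j) (j+[i-j]≡i i j) (ℤ.+-monoʳ-< j 0<i-j))
  (λ j<i → subst (ℤ._< i ℤ.- j) (ℤ.+-inverseʳ j) (ℤ.+-monoˡ-< (ℤ.- j) j<i))

i-j≤k⇔i≤j+k : ∀ {i j k} → i ℤ.- j ℤ.≤ k ⇔ i ℤ.≤ j ℤ.+ k
i-j≤k⇔i≤j+k {i} {j} {k} = mk⇔
  (λ i-j≤k → subst (ℤ._≤ j ℤ.+ k) (j+[i-j]≡i i j) (ℤ.+-monoʳ-≤ j i-j≤k))
  (λ i≤j+k → subst (i ℤ.- j ℤ.≤_) ([j+k]-j≡k j k) (ℤ.+-monoˡ-≤ (ℤ.- j) i≤j+k))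
  where
  [j+k]-j≡k : ∀ j k → j ℤ.+ k ℤ.- j ≡ k
  [j+k]-j≡k = ℤ-Solver.solve-∀

module _ {m n : ℕ} where

  0≤m-n⇔n≤m : + 0 ℤ.≤ + m ℤ.- + n ⇔ n ≤ m
  0≤m-n⇔n≤m = mk⇔ (ℤ.drop‿+≤+ ∘ ℤ.0≤i-j⇒j≤i) (ℤ.i≤j⇒0≤j-i ∘ +≤+)

  0<m-n⇔n<m : + 0 ℤ.< + m ℤ.- + n ⇔ n < m
  0<m-n⇔n<m = mk⇔ (ℤ.drop‿+<+ ∘ Equivalence.to 0<i-j⇔j<i) (Equivalence.from 0<i-j⇔j<i ∘ +<+)

  m-n≤c⇔m≤n+c : ∀ {c} → + m ℤ.- + n ℤ.≤ + c ⇔ m ≤ n + c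
  m-n≤c⇔m≤n+c {c} = mk⇔ (ℤ.drop‿+≤+ ∘ subst (+ m ℤ.≤_) (sym (ℤ.pos-+ n c)) ∘ Equivalence.to move)
                        (Equivalence.from move ∘ subst (+ m ℤ.≤_) (ℤ.pos-+ n c) ∘ +≤+)
    where move = i-j≤k⇔i≤j+k {+ m} {+ n} {+ c}

module _ (b : ℕ) .{{_ : NonZero b}} where

  m<[1+m/b]*b : ∀ m → m < suc (m / b) * b
  m<[1+m/b]*b m = begin-strict
    m                   ≡⟨ m≡m%n+[m/n]*n m b ⟩
    m % b + m / b * b   <⟨ +-monoˡ-< (m / b * b) (m%n<n m b) ⟩
    suc (m / b) * b     ∎
    where open ≤-Reasoning

  ≤/⇔*≤ : ∀ {q m} → q ≤ m / b ⇔ q * b ≤ m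
  ≤/⇔*≤ {q} {m} = mk⇔ (λ q≤ → ≤-trans (*-monoˡ-≤ b q≤) (m/n*n≤m m b))
    λ qb≤m → ≮⇒≥ λ m/b<q → <⇒≱ (m<[1+m/b]*b m) (≤-trans (*-monoˡ-≤ b m/b<q) qb≤m)

  /≡⇔ : ∀ {q m} → m / b ≡ q ⇔ (q * b ≤ m × m < suc q * b)
  /≡⇔ {q} {m} = mk⇔
    (λ { refl → m/n*n≤m m b , m<[1+m/b]*b m })
    (λ (qb≤m , m<) → ≤-antisym (≤-pred (m<n*o⇒m/o<n m<)) (Equivalence.from ≤/⇔*≤ qb≤m))

balance-≤ : ∀ {p q r s} → p + q ≡ r + s → p ≤ r ⇔ s ≤ q
balance-≤ {p} {q} {r} {s} eq = mk⇔
  (λ p≤r → +-cancelˡ-≤ r s q (subst (_≤ r + q) eq (+-monoˡ-≤ q p≤r)))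
  (λ s≤q → +-cancelʳ-≤ q p r (subst (_≤ r + q) (sym eq) (+-monoʳ-≤ r s≤q)))

balance-< : ∀ {p q r s} → p + q ≡ r + s → p < r ⇔ s < q
balance-< eq = mk⇔
  (λ p<r → ≰⇒> λ q≤s → <⇒≱ p<r (Equivalence.from (balance-≤ (sym eq)) q≤s))
  (λ s<q → ≰⇒> λ r≤p → <⇒≱ s<q (Equivalence.to (balance-≤ (sym eq)) r≤p))

module Cost (a b : ℕ) .{{_ : NonZero b}} where

  cost : ℕ → ℕ
  cost s = suc (((b ∸ s) * a) / b)

  quotient-window : ∀ {x q y} → x + suc q ≡ a → y ≤ b →
    ((b ∸ y) * a) / b ≡ q ⇔ (b * x < a * y × a * y ≤ b * x + b)
  quotient-window {x} {q} {y} x+1+q≡a y≤b = mk⇔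
    (λ eq → let (lo , hi) = Equivalence.to (/≡⇔ b) eq in Equivalence.to bal-< hi , Equivalence.to bal-≤ lo)
    (λ (pos , ≤b) → Equivalence.from (/≡⇔ b) (Equivalence.from bal-≤ ≤b , Equivalence.from bal-< pos))
    where
    j = (b ∸ y) * a
    total : j + a * y ≡ b * x + suc q * b
    total = begin
      j + a * y           ≡⟨ cong (_+_ j) (*-comm a y) ⟩
      (b ∸ y) * a + y * a ≡⟨ *-distribʳ-+ a (b ∸ y) y ⟨
      (b ∸ y + y) * a     ≡⟨ cong (_* a) (m∸n+n≡m y≤b) ⟩
      b * a               ≡⟨ cong (b *_) x+1+q≡a ⟨
      b * (x + suc q)     ≡⟨ *-distribˡ-+ b x (suc q) ⟩
      b * x + b * suc q   ≡⟨ cong (_+_ (b * x)) (*-comm b (suc q)) ⟩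
      b * x + suc q * b   ∎
      where open ≡-Reasoning
    regroup : ∀ q b x → q * b + (x + b) ≡ x + suc q * b
    regroup = solve-∀
    bal-< : j < suc q * b ⇔ b * x < a * y
    bal-< = balance-< (trans total (+-comm (b * x) _))
    bal-≤ : q * b ≤ j ⇔ a * y ≤ b * x + b
    bal-≤ = balance-≤ (trans (regroup q b (b * x)) (sym total))

  window⇒+cost : ∀ {x y} → b * x < a * y → a * y ≤ b * x + b → y ≤ b → x + cost y ≡ a
  window⇒+cost {x} {y} pos ≤b y≤b = trans (cong (λ q → x + suc q) quotient) x+1+q≡a
    where
    x<a : x < a
    x<a = *-cancelˡ-< b x a (<-≤-trans pos (≤-trans (*-monoʳ-≤ a y≤b) (≤-reflexive (*-comm a b))))
    x+1+q≡a : x + suc (a ∸ suc x) ≡ a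
    x+1+q≡a = trans (+-suc x _) (m+[n∸m]≡n x<a)
    quotient : ((b ∸ y) * a) / b ≡ a ∸ suc x
    quotient = Equivalence.from (quotient-window x+1+q≡a y≤b) (pos , ≤b)

  cost-window : ∀ {y} → 0 < a → 0 < y → y ≤ b →
    cost y ≤ a × b * (a ∸ cost y) < a * y × a * y ≤ b * (a ∸ cost y) + b
  cost-window {y} 0<a 0<y y≤b = cost≤a , Equivalence.to (quotient-window x+cost≡a y≤b) refl
    where
    cost≤a : cost y ≤ a
    cost≤a = m<n*o⇒m/o<n (begin-strict
      (b ∸ y) * a   <⟨ *-monoˡ-< a {{ℕ.>-nonZero 0<a}} (∸-monoʳ-< 0<y y≤b) ⟩
      b * a         ≡⟨ *-comm b a ⟩
      a * b         ∎)
      where open ≤-Reasoning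
    x+cost≡a : a ∸ cost y + cost y ≡ a
    x+cost≡a = m∸n+n≡m cost≤a

  coprime⇒gain+cost : Coprime a b → ∀ {y} → 0 < y → y < b → (y * a) / b + cost y ≡ a
  coprime⇒gain+cost coprime {y} 0<y y<b = window⇒+cost pos ≤b (<⇒≤ y<b)
    where
    x = (y * a) / b
    bounds = Equivalence.to (/≡⇔ b) (refl {x = x})
    bx≤ay : b * x ≤ a * y
    bx≤ay = subst₂ _≤_ (*-comm x b) (*-comm y a) (proj₁ bounds)
    pos : b * x < a * y
    pos = ≤∧≢⇒< bx≤ay λ bx≡ay → <⇒≱ y<b (∣⇒≤ {{ℕ.>-nonZero 0<y}}
      (coprime-divisor (Coprime.sym coprime) (divides x (trans (sym bx≡ay) (*-comm b x)))))
    ≤b : a * y ≤ b * x + b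
    ≤b = subst₂ _≤_ (*-comm y a) (trans (+-comm b (x * b)) (cong (_+ b) (*-comm x b))) (<⇒≤ (proj₂ bounds))

level-nonneg⇔≤/ : ∀ {a b x y} .{{_ : NonZero b}} → + 0 ℤ.≤ level a b (x , y) ⇔ x ≤ (y * a) / b
level-nonneg⇔≤/ {a} {b} {x} {y} = mk⇔
  (Equivalence.from (≤/⇔*≤ b) ∘ subst₂ _≤_ (*-comm b x) (*-comm a y) ∘ Equivalence.to 0≤m-n⇔n≤m)
  (Equivalence.from 0≤m-n⇔n≤m ∘ subst₂ _≤_ (*-comm x b) (*-comm y a) ∘ Equivalence.to (≤/⇔*≤ b))

-- Lattice paths and the labeled path

translate : ℕ → ℕ → ℕ × ℕ → ℕ × ℕ
translate dx dy (x , y) = x + dx , y + dy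

module _ {b : ℕ} where

  endpoint : Path b → ℕ × ℕ
  endpoint P = countE P , countN P

  countE-++ : ∀ (P R : Path b) → countE (P ++ R) ≡ countE P + countE R
  countE-++ [] R = refl
  countE-++ (E ∷ P) R = cong suc (countE-++ P R)
  countE-++ (N _ ∷ P) R = countE-++ P R

  countN-++ : ∀ (P R : Path b) → countN (P ++ R) ≡ countN P + countN R
  countN-++ [] R = refl
  countN-++ (E ∷ P) R = countN-++ P R
  countN-++ (N _ ∷ P) R = cong suc (countN-++ P R)

  endpoint-++ : ∀ (P R : Path b) → endpoint (P ++ R) ≡ (countE P + countE R , countN P + countN R)
  endpoint-++ P R = cong₂ _,_ (countE-++ P R) (countN-++ P R)

  countE-E* : ∀ n → countE {b} (replicate n E) ≡ n
  countE-E* zero = refl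
  countE-E* (suc n) = cong suc (countE-E* n)

  countN-E* : ∀ n → countN {b} (replicate n E) ≡ 0
  countN-E* zero = refl
  countN-E* (suc n) = countN-E* n

  length-northStarts : ∀ p (P : Path b) → length (northStarts p P) ≡ countN P
  length-northStarts p [] = refl
  length-northStarts (x , y) (E ∷ P) = length-northStarts (suc x , y) P
  length-northStarts (x , y) (N _ ∷ P) = cong suc (length-northStarts (x , suc y) P)

  northStarts-++ : ∀ x y (P R : Path b) →
    northStarts (x , y) (P ++ R) ≡ northStarts (x , y) P ++ northStarts (x + countE P , y + countN P) R
  northStarts-++ x y [] R rewrite +-identityʳ x | +-identityʳ y = refl
  northStarts-++ x y (E ∷ P) R rewrite northStarts-++ (suc x) y P R | +-suc x (countE P) = refl
  northStarts-++ x y (N _ ∷ P) R rewrite northStarts-++ x (suc y) P R | +-suc y (countN P) = refl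

  northStarts-E*-++ : ∀ x y n (R : Path b) → northStarts (x , y) (replicate n E ++ R) ≡ northStarts (x + n , y) R
  northStarts-E*-++ x y zero R rewrite +-identityʳ x = refl
  northStarts-E*-++ x y (suc n) R rewrite +-suc x n = northStarts-E*-++ (suc x) y n R

  northStarts-E* : ∀ p n → northStarts {b} p (replicate n E) ≡ []
  northStarts-E* p zero = refl
  northStarts-E* (x , y) (suc n) = northStarts-E* (suc x , y) n

  northStarts-translate : ∀ x y dx dy (P : Path b) →
    northStarts (x + dx , y + dy) P ≡ map (translate dx dy) (northStarts (x , y) P)
  northStarts-translate x y dx dy [] = refl
  northStarts-translate x y dx dy (E ∷ P) = northStarts-translate (suc x) y dx dy P
  northStarts-translate x y dx dy (N _ ∷ P) = cong (_ ∷_) (northStarts-translate x (suc y) dx dy P)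

module _ (a b : ℕ) where

  level-+ : ∀ x y dx dy → level a b (x + dx , y + dy) ≡ level a b (x , y) ℤ.+ level a b (dx , dy)
  level-+ x y dx dy
    rewrite *-distribˡ-+ a y dy | *-distribˡ-+ b x dx | ℤ.pos-+ (a * y) (a * dy) | ℤ.pos-+ (b * x) (b * dx)
    = regroup (+ (a * y)) (+ (a * dy)) (+ (b * x)) (+ (b * dx))
    where
    regroup : ∀ p q r s → (p ℤ.+ q) ℤ.- (r ℤ.+ s) ≡ (p ℤ.- r) ℤ.+ (q ℤ.- s)
    regroup = ℤ-Solver.solve-∀

  level-end : level a b (a , b) ≡ + 0
  level-end rewrite *-comm a b = ℤ.+-inverseʳ (+ (b * a))

  level-east : level a b (1 , 0) ≡ ℤ.- + b
  level-east rewrite *-zeroʳ a | *-identityʳ b = ℤ.+-identityˡ (ℤ.- + b)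

  level-north : level a b (0 , 1) ≡ + a
  level-north rewrite *-zeroʳ b | *-identityʳ a = ℤ.+-identityʳ (+ a)

  level-endpoint-++ : ∀ (P R : Path b) → level a b (endpoint (P ++ R)) ≡ level a b (endpoint P) ℤ.+ level a b (endpoint R)
  level-endpoint-++ P R = trans (cong (level a b) (endpoint-++ P R)) (level-+ (countE P) (countN P) (countE R) (countN R))

  map-level-translate : ∀ dx dy ps →
    map (level a b) (map (translate dx dy) ps) ≡ map (ℤ._+ level a b (dx , dy)) (map (level a b) ps)
  map-level-translate dx dy ps = begin
    map (level a b) (map (translate dx dy) ps)                ≡⟨ map-∘ {g = level a b} ps ⟨
    map (level a b ∘ translate dx dy) ps                      ≡⟨ map-cong (λ (x , y) → level-+ x y dx dy) ps ⟩
    map ((ℤ._+ level a b (dx , dy)) ∘ level a b) ps           ≡⟨ map-∘ {f = level a b} ps ⟩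
    map (ℤ._+ level a b (dx , dy)) (map (level a b) ps)       ∎
    where open ≡-Reasoning

  level-complement : ∀ {x y x′ y′} → x + x′ ≡ a → y + y′ ≡ b →
    level a b (x′ , y′) ≡ ℤ.- level a b (x , y)
  level-complement {x} {y} {x′} {y′} x+x′≡a y+y′≡b = begin
    level a b (x′ , y′)                                   ≡⟨ z≡[l+z]-l (level a b (x′ , y′)) L ⟩
    L ℤ.+ level a b (x′ , y′) ℤ.- L                       ≡⟨ cong (ℤ._- L) (level-+ x y x′ y′) ⟨
    level a b (x + x′ , y + y′) ℤ.- L
      ≡⟨ cong₂ (λ u v → level a b (u , v) ℤ.- L) x+x′≡a y+y′≡b ⟩
    level a b (a , b) ℤ.- L                               ≡⟨ cong (ℤ._- L) level-end ⟩
    + 0 ℤ.- L                                             ≡⟨ ℤ.+-identityˡ (ℤ.- L) ⟩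
    ℤ.- L                                                 ∎
    where
    open ≡-Reasoning
    L = level a b (x , y)
    z≡[l+z]-l : ∀ z l → z ≡ l ℤ.+ z ℤ.- l
    z≡[l+z]-l = ℤ-Solver.solve-∀

stairs : ℕ → List ℕ → List (ℕ × ℕ)
stairs y [] = []
stairs y (x ∷ xs) = (x , y) ∷ stairs (suc y) xs

stairs-++ : ∀ y (xs ys : List ℕ) → stairs y (xs ++ ys) ≡ stairs y xs ++ stairs (y + length xs) ys
stairs-++ y [] ys = cong (λ y → stairs y ys) (sym (+-identityʳ y))
stairs-++ y (x ∷ xs) ys = cong ((x , y) ∷_)
  (trans (stairs-++ (suc y) xs ys) (cong (λ y′ → stairs (suc y) xs ++ stairs y′ ys) (sym (+-suc y (length xs)))))

stairLevels : ℕ → ℕ → ℕ → List ℕ → List ℤ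
stairLevels a b y xs = map (level a b) (stairs y xs)

stairLevels-++ : ∀ a b y (xs ys : List ℕ) →
  stairLevels a b y (xs ++ ys) ≡ stairLevels a b y xs ++ stairLevels a b (y + length xs) ys
stairLevels-++ a b y xs ys = trans (cong (map (level a b)) (stairs-++ y xs ys)) (map-++ (level a b) (stairs y xs) _)

length-stairs : ∀ y xs → length (stairs y xs) ≡ length xs
length-stairs y [] = refl
length-stairs y (x ∷ xs) = cong suc (length-stairs (suc y) xs)

stairs-translate : ∀ y dx dy xs → stairs (y + dy) (map (_+ dx) xs) ≡ map (translate dx dy) (stairs y xs)
stairs-translate y dx dy [] = refl
stairs-translate y dx dy (x ∷ xs) = cong (_ ∷_) (stairs-translate (suc y) dx dy xs)

stairLevels-translate : ∀ a b y dx dy xs →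
  stairLevels a b (y + dy) (map (_+ dx) xs) ≡ map (ℤ._+ level a b (dx , dy)) (stairLevels a b y xs)
stairLevels-translate a b y dx dy xs =
  trans (cong (map (level a b)) (stairs-translate y dx dy xs)) (map-level-translate a b dx dy (stairs y xs))

module _ {b : ℕ} where

  take-E*-++ : ∀ {m n} (R : Path b) → m ≤ n → take m (replicate n E ++ R) ≡ replicate m E
  take-E*-++ {zero} R _ = refl
  take-E*-++ {suc m} {suc n} R (s≤s m≤n) = cong (E ∷_) (take-E*-++ R m≤n)

  take-E*-N-++ : ∀ n m w (R : Path b) → take (n + suc m) (replicate n E ++ N w ∷ R) ≡ replicate n E ++ N w ∷ take m R
  take-E*-N-++ zero m w R = refl
  take-E*-N-++ (suc n) m w R = cong (E ∷_) (take-E*-N-++ n m w R)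

  endpoint-E* : ∀ m → endpoint {b} (replicate m E) ≡ (m , 0)
  endpoint-E* m = cong₂ _,_ (countE-E* m) (countN-E* m)

  countN-take-E* : ∀ m n → countN {b} (take m (replicate n E)) ≡ 0
  countN-take-E* zero n = refl
  countN-take-E* (suc m) zero = refl
  countN-take-E* (suc m) (suc n) = countN-take-E* m n

  take-E* : ∀ {m n} → m ≤ n → take m (replicate {A = Step b} n E) ≡ replicate m E
  take-E* {m} {n} m≤n = trans (cong (take m) (sym (++-identityʳ (replicate n E)))) (take-E*-++ [] m≤n)

  countE-take-E*-N : ∀ n m w (R : Path b) → countE (take (n + suc m) (replicate n E ++ N w ∷ R)) ≡ n + countE (take m R)
  countE-take-E*-N n m w R rewrite take-E*-N-++ n m w R | countE-++ (replicate n E) (N w ∷ take m R) | countE-E* {b} n = refl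

  countN-take-E*-N : ∀ n m w (R : Path b) → countN (take (n + suc m) (replicate n E ++ N w ∷ R)) ≡ suc (countN (take m R))
  countN-take-E*-N n m w R rewrite take-E*-N-++ n m w R | countN-++ (replicate n E) (N w ∷ take m R) | countN-E* {b} n = refl

module _ {b : ℕ} (D : Config b) where

  val : Fin b → ℕ
  val w = ℤ.∣ D w ∣

  ThresholdSplit : ℕ → List (Fin b) → List (Fin b) → List (Fin b) → Set
  ThresholdSplit x ws A B = ws ≡ A ++ B × All (λ w → val w ≤ x) A × All (λ w → x ≤ val w) B

  Ascending : List (Fin b) → Set
  Ascending = AllPairs (_≤_ on val)

  threshold-split : ∀ x ws → Ascending ws →
    ∃₂ λ A B → ws ≡ A ++ B × All (λ w → val w < x) A × All (λ w → x ≤ val w) B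
  threshold-split x [] [] = [] , [] , refl , [] , []
  threshold-split x (w ∷ ws) (w≤ws ∷ ascending) with val w <? x
  ... | no w≮x = [] , w ∷ ws , refl , [] , ≮⇒≥ w≮x ∷ All.map (≤-trans (≮⇒≥ w≮x)) w≤ws
  ... | yes w<x with threshold-split x ws ascending
  ...   | A , B , ws≡ , A<x , x≤B = w ∷ A , B , cong (w ∷_) ws≡ , w<x ∷ A<x , x≤B

  sortedVerts-ascending : NonNeg D → Ascending (sortedVerts D)
  sortedVerts-ascending nn = AllPairs.map (λ {v} {w} → abs-mono (nn v)) (sortedVerts-sorted D)
    where
    abs-mono : ∀ {i j} → + 0 ℤ.≤ i → i ℤ.≤ j → ℤ.∣ i ∣ ≤ ℤ.∣ j ∣
    abs-mono (+≤+ _) (+≤+ i≤j) = i≤j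

  module _ (a : ℕ) where

    northStarts-lpathFrom : ∀ cur y ws → All ((cur ≤_) ∘ val) ws → Ascending ws →
      northStarts (cur , y) (lpathFrom a D cur ws) ≡ stairs y (map val ws)
    northStarts-lpathFrom cur y [] _ _ with cur ≤ᵇ a
    ... | true = northStarts-E* (cur , y) (a ∸ cur)
    ... | false = refl
    northStarts-lpathFrom cur y (w ∷ ws) (cur≤w ∷ _) (w≤ws ∷ ascending)
      rewrite northStarts-E*-++ cur y (val w ∸ cur) (N w ∷ lpathFrom a D (val w) ws) | m+[n∸m]≡n cur≤w
      = cong ((val w , y) ∷_) (northStarts-lpathFrom (val w) (suc y) ws w≤ws ascending)

    countN-lpathFrom : ∀ cur ws → countN (lpathFrom a D cur ws) ≡ length ws
    countN-lpathFrom cur [] with cur ≤ᵇ a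
    ... | true = countN-E* (a ∸ cur)
    ... | false = refl
    countN-lpathFrom cur (w ∷ ws)
      rewrite countN-++ (replicate (val w ∸ cur) E) (N w ∷ lpathFrom a D (val w) ws) | countN-E* {b} (val w ∸ cur)
      = cong suc (countN-lpathFrom (val w) ws)

    countE-lpathFrom : ∀ cur ws → cur ≤ a → All ((cur ≤_) ∘ val) ws → Ascending ws → All ((_≤ a) ∘ val) ws →
      cur + countE (lpathFrom a D cur ws) ≡ a
    countE-lpathFrom cur [] cur≤a _ _ _
      rewrite Equivalence.to T-≡ (≤⇒≤ᵇ cur≤a) | countE-E* {b} (a ∸ cur) = m+[n∸m]≡n cur≤a
    countE-lpathFrom cur (w ∷ ws) cur≤a (cur≤w ∷ _) (w≤ws ∷ ascending) (w≤a ∷ ws≤a)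
      rewrite countE-++ (replicate (val w ∸ cur) E) (N w ∷ lpathFrom a D (val w) ws) | countE-E* {b} (val w ∸ cur)
      = begin
        cur + ((val w ∸ cur) + countE rest)   ≡⟨ +-assoc cur (val w ∸ cur) _ ⟨
        cur + (val w ∸ cur) + countE rest     ≡⟨ cong (_+ countE rest) (m+[n∸m]≡n cur≤w) ⟩
        val w + countE rest                   ≡⟨ countE-lpathFrom (val w) ws w≤a w≤ws ascending ws≤a ⟩
        a                                     ∎
      where
      open ≡-Reasoning
      rest = lpathFrom a D (val w) ws

    lpathFrom-point⇒split : ∀ cur ws m → All ((cur ≤_) ∘ val) ws → Ascending ws →
      let (x , y) = pointAt m (lpathFrom a D cur ws) in
      ∃₂ λ A B → ThresholdSplit (cur + x) ws A B × length A ≡ y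
    lpathFrom-point⇒split cur [] m _ _ = [] , [] , (refl , [] , []) , sym no-north
      where
      no-north : countN (take m (lpathFrom a D cur [])) ≡ 0
      no-north with cur ≤ᵇ a
      ... | true = countN-take-E* m (a ∸ cur)
      ... | false = countN-take-E* m 0
    lpathFrom-point⇒split cur (w ∷ ws) m (cur≤w ∷ _) (w≤ws ∷ ascending) with compare-≤ m (val w ∸ cur)
    ... | within m≤k rewrite take-E*-++ (N w ∷ lpathFrom a D (val w) ws) m≤k | countE-E* {b} m | countN-E* {b} m =
      [] , w ∷ ws , (refl , [] , cur+m≤w ∷ All.map (≤-trans cur+m≤w) w≤ws) , refl
      where
      cur+m≤w : cur + m ≤ val w
      cur+m≤w = ≤-trans (+-monoʳ-≤ cur m≤k) (≤-reflexive (m+[n∸m]≡n cur≤w))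
    ... | beyond m′
      rewrite countE-take-E*-N (val w ∸ cur) m′ w (lpathFrom a D (val w) ws)
            | countN-take-E*-N (val w ∸ cur) m′ w (lpathFrom a D (val w) ws)
            | sym (+-assoc cur (val w ∸ cur) (countE (take m′ (lpathFrom a D (val w) ws)))) | m+[n∸m]≡n cur≤w
      with lpathFrom-point⇒split (val w) ws m′ w≤ws ascending
    ... | A , B , (ws≡ , A≤ , ≤B) , len =
      w ∷ A , B , (cong (w ∷_) ws≡ , m≤m+n (val w) _ ∷ A≤ , ≤B) , cong suc len

    split⇒lpathFrom-point : ∀ {cur x ws A B} → ThresholdSplit x ws A B → All ((cur ≤_) ∘ val) ws → Ascending ws →
      cur ≤ x → x ≤ a → ∃ λ m → pointAt m (lpathFrom a D cur ws) ≡ (x ∸ cur , length A)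
    split⇒lpathFrom-point {cur} {x} {A = []} {[]} (refl , [] , []) _ _ cur≤x x≤a
      rewrite Equivalence.to T-≡ (≤⇒≤ᵇ (≤-trans cur≤x x≤a))
      = x ∸ cur , trans (cong endpoint (take-E* (∸-monoˡ-≤ cur x≤a))) (endpoint-E* (x ∸ cur))
    split⇒lpathFrom-point {cur} {x} {A = []} {w ∷ B} (refl , [] , x≤w ∷ _) _ _ cur≤x x≤a
      = x ∸ cur
      , trans (cong endpoint (take-E*-++ (N w ∷ lpathFrom a D (val w) B) (∸-monoˡ-≤ cur x≤w))) (endpoint-E* (x ∸ cur))
    split⇒lpathFrom-point {cur} {x} {A = w ∷ A} {B}
      (refl , w≤x ∷ A≤ , ≤B) (cur≤w ∷ _) (w≤ws ∷ ascending) cur≤x x≤a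
      with split⇒lpathFrom-point {val w} (refl , A≤ , ≤B) w≤ws ascending w≤x x≤a
    ... | m′ , point = k + suc m′ , point′
      where
      k = val w ∸ cur
      rest = lpathFrom a D (val w) (A ++ B)
      point′ : pointAt (k + suc m′) (replicate k E ++ N w ∷ rest) ≡ (x ∸ cur , suc (length A))
      point′ rewrite countE-take-E*-N k m′ w rest | countN-take-E*-N k m′ w rest =
        cong₂ _,_ (trans (cong (_+_ k) (cong proj₁ point)) (∸-telescope cur≤w w≤x)) (cong suc (cong proj₂ point))

-- Stability

module _ {Q : ℤ → Set} (f : ℕ × ℕ → ℤ) (e : A → ℕ) where

  stairs-inversion : ∀ y ws {L₁ z L₂} → map f (stairs y (map e ws)) ≡ L₁ ++ z ∷ L₂ →
    ∃₂ λ P B → ∃ λ w → ws ≡ P ++ w ∷ B × z ≡ f (e w , y + length P) × length B ≡ length L₂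
  stairs-inversion y (w ∷ ws) {[]} refl =
    [] , ws , w , refl , cong (λ y → f (e w , y)) (sym (+-identityʳ y)) ,
    sym (trans (length-map f (stairs (suc y) (map e ws))) (trans (length-stairs (suc y) (map e ws)) (length-map e ws)))
  stairs-inversion y (w ∷ ws) {_ ∷ L₁} eq with stairs-inversion (suc y) ws (∷-injectiveʳ eq)
  ... | P , B , v , ws≡ , z≡ , len =
    w ∷ P , B , v , cong (w ∷_) ws≡ , trans z≡ (cong (λ y → f (e v , y)) (sym (+-suc y (length P)))) , len

  All-lastN-stairs⇔ : ∀ n ws →
    All Q (lastN n (map f (stairs 0 (map e ws)))) ⇔
    (∀ P w B → ws ≡ P ++ w ∷ B → length B < n → Q (f (e w , length P)))
  All-lastN-stairs⇔ n ws = mk⇔ to from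
    where
    to : All Q (lastN n (map f (stairs 0 (map e ws)))) →
         ∀ P w B → ws ≡ P ++ w ∷ B → length B < n → Q (f (e w , length P))
    to h P w B refl B< = All-lastN-∷⁻ (map f (stairs 0 (map e P))) (map f (stairs (suc (length P)) (map e B)))
      (subst (λ l → All Q (lastN n l)) splitting h) (subst (_< n) (sym lenB) B<)
      where
      splitting : map f (stairs 0 (map e (P ++ w ∷ B))) ≡
                  map f (stairs 0 (map e P)) ++ f (e w , length P) ∷ map f (stairs (suc (length P)) (map e B))
      splitting rewrite map-++ e P (w ∷ B) | stairs-++ 0 (map e P) (map e (w ∷ B)) | length-map e P =
        map-++ f (stairs 0 (map e P)) _
      lenB : length (map f (stairs (suc (length P)) (map e B))) ≡ length B
      lenB = trans (length-map f (stairs (suc (length P)) (map e B)))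
                   (trans (length-stairs (suc (length P)) (map e B)) (length-map e B))
    from : (∀ P w B → ws ≡ P ++ w ∷ B → length B < n → Q (f (e w , length P))) →
           All Q (lastN n (map f (stairs 0 (map e ws))))
    from h = All-lastN-∷⁺ n _ λ L₁ z L₂ eq L₂< → case stairs-inversion 0 ws eq of λ where
      (P , B , w , ws≡ , refl , len) → h P w B ws≡ (subst (_< n) (sym len) L₂<)

module _ (a b : ℕ) .{{_ : NonZero b}} where

  open Cost a b

  nonneg⇒≡+val : ∀ {C : Config b} → NonNeg C → ∀ i → C i ≡ + val C i
  nonneg⇒≡+val nn i = sym (ℤ.0≤i⇒+∣i∣≡i (nn i))

  fire-inside : ∀ {S C i} → lookup S i ≡ true → fire a b S C i ≡ C i ℤ.- + cost ∣ S ∣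
  fire-inside inS rewrite inS = refl

  fire-legal⇔ : ∀ {C} S → NonNeg C →
    NonNeg (fire a b S C) ⇔ (∀ i → lookup S i ≡ true → cost ∣ S ∣ ≤ val C i)
  fire-legal⇔ {C} S nn = mk⇔
    (λ legal i inS → Equivalence.to 0≤m-n⇔n≤m (subst (+ 0 ℤ.≤_) (after-fire inS) (legal i)))
    λ costs≤ i → case-on i costs≤
    where
    after-fire : ∀ {i} → lookup S i ≡ true → fire a b S C i ≡ + val C i ℤ.- + cost ∣ S ∣
    after-fire {i} inS = trans (fire-inside {S} {C} inS) (cong (ℤ._- + cost ∣ S ∣) (nonneg⇒≡+val nn i))
    case-on : ∀ i → (∀ i → lookup S i ≡ true → cost ∣ S ∣ ≤ val C i) → + 0 ℤ.≤ fire a b S C i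
    case-on i costs≤ with lookup S i in eq
    ... | true = subst (λ c → + 0 ℤ.≤ c ℤ.- + cost ∣ S ∣) (sym (nonneg⇒≡+val nn i))
                       (Equivalence.from 0≤m-n⇔n≤m (costs≤ i eq))
    ... | false = ℤ.+-mono-≤ (nn i) (+≤+ z≤n)

  module _ (k : ℕ) {C : Config b} (nn : NonNeg C) {ws : List (Fin b)}
           (enum : IsEnumeration ws) (ascending : Ascending C ws) where

    TailBounded : Set
    TailBounded = ∀ P w B → ws ≡ P ++ w ∷ B → length B < suc k → val C w ≤ (length P * a) / b

    kStable⇒tailBounded : KStable a b k C → TailBounded
    kStable⇒tailBounded (_ , stable) P w B refl B<1+k = ≮⇒≥ λ bound<w →
      stable S (subst (0 <_) (sym ∣S∣≡) (s≤s z≤n)) (subst (_≤ suc k) (sym ∣S∣≡) B<1+k)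
        (Equivalence.from (fire-legal⇔ S nn) (legal bound<w))
      where
      S = setOf (w ∷ B)
      enum′ : IsEnumeration ((w ∷ B) ++ P)
      enum′ = enumeration-swap P enum
      inside = proj₁ (setOf-split (w ∷ B) enum′)
      outside = proj₂ (setOf-split (w ∷ B) enum′)
      ∣S∣≡ : ∣ S ∣ ≡ suc (length B)
      ∣S∣≡ = count-split S (w ∷ B) enum′ inside outside
      b∸∣S∣≡ : b ∸ ∣ S ∣ ≡ length P
      b∸∣S∣≡ = begin
        b ∸ ∣ S ∣
          ≡⟨ cong₂ _∸_ (enumeration-length (P ++ w ∷ B) enum) (sym ∣S∣≡) ⟨
        length (P ++ w ∷ B) ∸ suc (length B)     ≡⟨ cong (_∸ suc (length B)) (length-++ P) ⟩
        length P + suc (length B) ∸ suc (length B) ≡⟨ m+n∸n≡m (length P) (suc (length B)) ⟩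
        length P                                 ∎
        where open ≡-Reasoning
      w≤wB : All (λ v → val C w ≤ val C v) (w ∷ B)
      w≤wB = ≤-refl ∷ AllPairs.head (proj₁ (proj₂ (AllPairs-++⁻ P ascending)))
      legal : (length P * a) / b < val C w → ∀ i → lookup S i ≡ true → cost ∣ S ∣ ≤ val C i
      legal bound<w i inS with ∈-++⁻ P (enumeration-∈ {i = i} enum)
      ... | inj₁ i∈P = contradiction (trans (sym (All.lookup outside i∈P)) inS) (λ ())
      ... | inj₂ i∈wB = subst (λ j → suc ((j * a) / b) ≤ val C i) (sym b∸∣S∣≡)
                          (≤-trans bound<w (All.lookup w≤wB i∈wB))

    tailBounded⇒kStable : TailBounded → KStable a b k C
    tailBounded⇒kStable bounded = nn , unstable
      where
      unstable : ∀ S → 0 < ∣ S ∣ → ∣ S ∣ ≤ suc k → ¬ NonNeg (fire a b S C)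
      unstable S 0<∣S∣ ∣S∣≤1+k legal with split-at {j = b ∸ ∣ S ∣} ws j<
        where j< = subst (b ∸ ∣ S ∣ <_) (sym (enumeration-length ws enum)) (∸-monoʳ-< 0<∣S∣ (∣p∣≤n S))
      ... | P , B , w , refl , lenP = <-irrefl refl (begin-strict
        ∣ S ∣                          ≡⟨ enum S ⟨
        count S (P ++ w ∷ B)           ≡⟨ cong (count S) (++-assoc P (w ∷ []) B) ⟨
        count S ((P ++ w ∷ []) ++ B)   ≡⟨ count-++ S (P ++ w ∷ []) B ⟩
        count S (P ++ w ∷ []) + count S B
                                       ≡⟨ cong (_+ count S B) (count-outside (++⁺ (All.map not-in P≤w) (not-in ≤-refl ∷ []))) ⟩
        count S B                      ≤⟨ count≤length S B ⟩
        length B                       <⟨ ≤-refl ⟩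
        suc (length B)                 ≡⟨ 1+B≡∣S∣ ⟩
        ∣ S ∣                          ∎)
        where
        open ≤-Reasoning
        1+B≡∣S∣ : suc (length B) ≡ ∣ S ∣
        1+B≡∣S∣ = begin-equality
          suc (length B)                        ≡⟨ m+n∸m≡n (length P) (suc (length B)) ⟨
          length P + suc (length B) ∸ length P  ≡⟨ cong₂ _∸_ (length-++ P) (sym lenP) ⟨
          length (P ++ w ∷ B) ∸ (b ∸ ∣ S ∣)
            ≡⟨ cong (_∸ (b ∸ ∣ S ∣)) (enumeration-length (P ++ w ∷ B) enum) ⟩
          b ∸ (b ∸ ∣ S ∣)                       ≡⟨ m∸[m∸n]≡n (∣p∣≤n S) ⟩
          ∣ S ∣                                 ∎
        costs : ∀ i → lookup S i ≡ true → cost ∣ S ∣ ≤ val C i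
        costs = Equivalence.to (fire-legal⇔ S nn) legal
        w≤bound : val C w ≤ (length P * a) / b
        w≤bound = bounded P w B refl (subst (_≤ suc k) (sym 1+B≡∣S∣) ∣S∣≤1+k)
        not-in : ∀ {v} → val C v ≤ val C w → lookup S v ≡ false
        not-in {v} v≤w with lookup S v in eq
        ... | false = refl
        ... | true = contradiction (≤-trans (costs v eq) (≤-trans v≤w w≤bound))
                       (subst (λ j → ¬ suc ((j * a) / b) ≤ (length P * a) / b) lenP (n≮n _))
        P≤w : All (λ v → val C v ≤ val C w) P
        P≤w = All.map All.head (proj₂ (proj₂ (AllPairs-++⁻ P ascending)))

    kStable⇔tailLevels : KStable a b k C ⇔ TailAbove k (+ 0) (stairLevels a b 0 (map (val C) ws))
    kStable⇔tailLevels = mk⇔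
      (λ stable → Equivalence.from positional λ P w B ws≡ B< →
        Equivalence.from (level-nonneg⇔≤/ {a} {b}) (kStable⇒tailBounded stable P w B ws≡ B<))
      (λ tail → tailBounded⇒kStable λ P w B ws≡ B< →
        Equivalence.to (level-nonneg⇔≤/ {a} {b}) (Equivalence.to positional tail P w B ws≡ B<))
      where positional = All-lastN-stairs⇔ (level a b) (val C) (suc k) ws

-- Cyclic shifts and borrowing

module _ (a b : ℕ) where

  northLevels : ℕ × ℕ → Path b → List ℤ
  northLevels p P = map (level a b) (northStarts p P)

  R1⇔tailAbove : ∀ k Q → R1 a b k Q ⇔ TailAbove k (+ 0) (northLevels (0 , 0) Q)
  R1⇔tailAbove k Q = ⇔-trans AllL⇔All (⇔-sym (All-lastN-map⇔ (suc k) (level a b) (northStarts (0 , 0) Q)))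

  northLevels-++ : ∀ x y (P R : Path b) →
    northLevels (x , y) (P ++ R) ≡ northLevels (x , y) P ++ northLevels (x + countE P , y + countN P) R
  northLevels-++ x y P R = trans (cong (map (level a b)) (northStarts-++ x y P R)) (map-++ (level a b) (northStarts (x , y) P) _)

  northLevels-translate : ∀ x y dx dy (P : Path b) →
    northLevels (x + dx , y + dy) P ≡ map (ℤ._+ level a b (dx , dy)) (northLevels (x , y) P)
  northLevels-translate x y dx dy P =
    trans (cong (map (level a b)) (northStarts-translate x y dx dy P)) (map-level-translate a b dx dy (northStarts (x , y) P))

  module _ (U R : Path b) (Eₜ : countE U + countE R ≡ a) (Nₜ : countN U + countN R ≡ b) where

    private
      L = level a b (endpoint U)

    northLevels-shift : northLevels (0 , 0) (R ++ U) ≡ map (ℤ._- L) (northLevels (endpoint U) R ++ northLevels (0 , 0) U)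
    northLevels-shift = begin
      northLevels (0 , 0) (R ++ U)
        ≡⟨ northLevels-++ 0 0 R U ⟩
      northLevels (0 , 0) R ++ northLevels (countE R , countN R) U
        ≡⟨ cong₂ _++_ (sym (map-+-− L (northLevels (0 , 0) R))) (northLevels-translate 0 0 (countE R) (countN R) U) ⟩
      map (ℤ._- L) (map (ℤ._+ L) (northLevels (0 , 0) R)) ++ map (ℤ._+ level a b (endpoint R)) (northLevels (0 , 0) U)
        ≡⟨ cong₂ (λ xs c → map (ℤ._- L) xs ++ map (ℤ._+ c) (northLevels (0 , 0) U))
                 (sym (northLevels-translate 0 0 (countE U) (countN U) R)) (level-complement a b Eₜ Nₜ) ⟩
      map (ℤ._- L) (northLevels (endpoint U) R) ++ map (ℤ._- L) (northLevels (0 , 0) U)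
        ≡⟨ map-++ (ℤ._- L) (northLevels (endpoint U) R) _ ⟨
      map (ℤ._- L) (northLevels (endpoint U) R ++ northLevels (0 , 0) U) ∎
      where open ≡-Reasoning

    R1-shift⇔ : ∀ k → R1 a b k (R ++ U) ⇔ TailAbove k L (northLevels (endpoint U) R ++ northLevels (0 , 0) U)
    R1-shift⇔ k = ⇔-trans (R1⇔tailAbove k (R ++ U))
      (⇔-trans (≡⇒⇔ (cong (TailAbove k (+ 0)) northLevels-shift))
               (tailAbove-shift⇔ k L (northLevels (endpoint U) R ++ northLevels (0 , 0) U)))

module _ {b : ℕ} (U : Path b) where

  endpoint-∷ʳE : endpoint (U ++ E ∷ []) ≡ (suc (countE U) , countN U)
  endpoint-∷ʳE = cong₂ _,_ (trans (countE-++ U (E ∷ [])) (+-comm (countE U) 1))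
                           (trans (countN-++ U (E ∷ [])) (+-identityʳ (countN U)))

  endpoint-∷ʳN : ∀ w → endpoint (U ++ N w ∷ []) ≡ (countE U , suc (countN U))
  endpoint-∷ʳN w = cong₂ _,_ (trans (countE-++ U (N w ∷ [])) (+-identityʳ (countE U)))
                             (trans (countN-++ U (N w ∷ [])) (+-comm (countN U) 1))

Window : (a b : ℕ) → Path b → Set
Window a b U = + 0 ℤ.< level a b (endpoint U) × level a b (endpoint U) ℤ.≤ + b

module _ (a b k : ℕ) where

  shiftLevels : Path b → Path b → List ℤ
  shiftLevels U R = northLevels a b (endpoint U) R ++ northLevels a b (0 , 0) U

  ShiftR1 : Path b → Path b → Set
  ShiftR1 U R = TailAbove k (level a b (endpoint U)) (shiftLevels U R)

  shiftLevels-∷ʳE : ∀ U R → shiftLevels (U ++ E ∷ []) R ≡ shiftLevels U (E ∷ R)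
  shiftLevels-∷ʳE U R rewrite endpoint-∷ʳE U | northLevels-++ a b 0 0 U (E ∷ []) =
    cong (northLevels a b (suc (countE U) , countN U) R ++_) (++-identityʳ (northLevels a b (0 , 0) U))

  shiftLevels-∷ʳN : ∀ U w R → shiftLevels (U ++ N w ∷ []) R ≡
    northLevels a b (countE U , suc (countN U)) R ++ northLevels a b (0 , 0) U ++ level a b (endpoint U) ∷ []
  shiftLevels-∷ʳN U w R rewrite endpoint-∷ʳN U w | northLevels-++ a b 0 0 U (N w ∷ []) = refl

  module _ (Q : Path b) (Eₜ : countE Q ≡ a) (Nₜ : countN Q ≡ b) where

    WindowedShiftR1 : Set
    WindowedShiftR1 = ∃₂ λ U R → U ++ R ≡ Q × Window a b U × ShiftR1 U R

    walk-to-window : ∀ U R → U ++ R ≡ Q → + b ℤ.< level a b (endpoint U) →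
      All (+ b ℤ.<_) (lastN (suc k) (shiftLevels U R)) → WindowedShiftR1
    walk-to-window U [] U≡Q b<L _ = contradiction (subst (+ b ℤ.<_) level-Q b<L) λ { (+<+ ()) }
      where
      level-Q : level a b (endpoint U) ≡ + 0
      level-Q = trans (cong (level a b ∘ endpoint) (trans (sym (++-identityʳ U)) U≡Q))
                      (trans (cong₂ (λ x y → level a b (x , y)) Eₜ Nₜ) (level-end a b))
    walk-to-window U (N w ∷ R) U≡Q b<L above =
      walk-to-window (U ++ N w ∷ []) R (trans (++-assoc U (N w ∷ []) R) U≡Q) b<L′
        (subst (All _ ∘ lastN (suc k)) (sym (shiftLevels-∷ʳN U w R))
          (All-lastN-rotate (suc k) (level a b (endpoint U) ∷ []) (northLevels a b (countE U , suc (countN U)) R)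
            (northLevels a b (0 , 0) U) (b<L ∷ []) above))
      where
      b<L′ : + b ℤ.< level a b (endpoint (U ++ N w ∷ []))
      b<L′ = ℤ.<-≤-trans b<L (ℤ.≤-trans (ℤ.i≤i+j _ (+ a)) (ℤ.≤-reflexive (sym
        (trans (level-endpoint-++ a b U (N w ∷ [])) (cong (ℤ._+_ (level a b (endpoint U))) (level-north a b))))))
    walk-to-window U (E ∷ R) U≡Q b<L above with level a b (endpoint (U ++ E ∷ [])) ℤ.≤? + b
    ... | yes L′≤b = U ++ E ∷ [] , R , U′≡Q , (0<L′ , L′≤b) ,
      subst (All _ ∘ lastN (suc k)) (sym (shiftLevels-∷ʳE U R))
        (All.map (λ b<z → ℤ.≤-trans L′≤b (ℤ.<⇒≤ b<z)) above)
      where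
      U′≡Q = trans (++-assoc U (E ∷ []) R) U≡Q
      0<L′ : + 0 ℤ.< level a b (endpoint (U ++ E ∷ []))
      0<L′ = subst (+ 0 ℤ.<_)
        (sym (trans (level-endpoint-++ a b U (E ∷ [])) (cong (ℤ._+_ (level a b (endpoint U))) (level-east a b))))
                   (Equivalence.from 0<i-j⇔j<i b<L)
    ... | no L′≰b = walk-to-window (U ++ E ∷ []) R (trans (++-assoc U (E ∷ []) R) U≡Q) (ℤ.≰⇒> L′≰b)
      (subst (All _ ∘ lastN (suc k)) (sym (shiftLevels-∷ʳE U R)) above)

    shiftR1⇒windowed : ∀ U R → U ++ R ≡ Q → + 0 ℤ.< level a b (endpoint U) → ShiftR1 U R → WindowedShiftR1
    shiftR1⇒windowed U R U++R≡Q pos good with level a b (endpoint U) ℤ.≤? + b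
    ... | yes L≤b = U , R , U++R≡Q , (pos , L≤b) , good
    ... | no L≰b = walk-to-window U R U++R≡Q (ℤ.≰⇒> L≰b) (All.map (ℤ.<-≤-trans (ℤ.≰⇒> L≰b)) good)

module _ (a b : ℕ) .{{_ : NonZero b}} where

  open Cost a b

  borrow-inside : ∀ {C} → NonNeg C → ∀ T {i} → lookup T i ≡ true → borrow a b T C i ≡ + (val C i + cost ∣ T ∣)
  borrow-inside {C} nn T {i} inT rewrite inT =
    trans (cong (ℤ._+ + cost ∣ T ∣) (nonneg⇒≡+val a b nn i)) (sym (ℤ.pos-+ (val C i) (cost ∣ T ∣)))

  borrow-outside : ∀ {C} → NonNeg C → ∀ T {i} → lookup T i ≡ false →
    borrow a b T C i ≡ + val C i ℤ.- + ((∣ T ∣ * a) / b)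
  borrow-outside {C} nn T {i} outT rewrite outT = cong (ℤ._- + ((∣ T ∣ * a) / b)) (nonneg⇒≡+val a b nn i)

  module BorrowShift (coprime : Coprime a b) (k : ℕ) {D : Config b} (nn : NonNeg D)
    {ws : List (Fin b)} (enum : IsEnumeration ws) (ascending : Ascending D ws) (below-a : ∀ w → val D w < a)
    {T : Subset b} {x : ℕ} {A B : List (Fin b)} (ws≡ : ws ≡ A ++ B) (x≤B : All (λ w → x ≤ val D w) B)
    (0<y : 0 < length A) (x+cost≡a : x + cost (length A) ≡ a)
    (inT : All (λ i → lookup T i ≡ true) A) (outT : All (λ i → lookup T i ≡ false) B) where

    private
      y = length A
      D′ = borrow a b T D
      enumAB : IsEnumeration (A ++ B)
      enumAB = subst IsEnumeration ws≡ enum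
      ∣T∣≡y : ∣ T ∣ ≡ y
      ∣T∣≡y = count-split T A enumAB inT outT
      y+B≡b : y + length B ≡ b
      y+B≡b = trans (sym (length-++ A)) (enumeration-length (A ++ B) enumAB)

    gain≡x : ∀ {i} → i ∈ B → (∣ T ∣ * a) / b ≡ x
    gain≡x {i} i∈B = +-cancelʳ-≡ (cost y) _ x
      (trans (cong (λ s → (s * a) / b + cost y) ∣T∣≡y) (trans (coprime⇒gain+cost coprime 0<y y<b) (sym x+cost≡a)))
      where
      y<b : y < b
      y<b = subst (y <_) y+B≡b (m<m+n y (∈⇒0<length i∈B))

    borrowed-A : All (λ w → D′ w ≡ + (val D w + cost y)) A
    borrowed-A = All.map (λ {w} w∈T → trans (borrow-inside nn T w∈T) (cong (λ s → + (val D w + cost s)) ∣T∣≡y))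
                         inT

    borrowed-B : All (λ w → D′ w ≡ + (val D w ∸ x)) B
    borrowed-B = All.tabulate λ {w} w∈B → begin
      D′ w                                ≡⟨ borrow-outside nn T (All.lookup outT w∈B) ⟩
      + val D w ℤ.- + ((∣ T ∣ * a) / b)   ≡⟨ cong (λ g → + val D w ℤ.- + g) (gain≡x w∈B) ⟩
      + val D w ℤ.- + x                   ≡⟨ ℤ.m-n≡m⊖n (val D w) x ⟩
      val D w ℤ.⊖ x                       ≡⟨ ℤ.⊖-≥ (All.lookup x≤B w∈B) ⟩
      + (val D w ∸ x)                     ∎
      where open ≡-Reasoning

    borrow-nonneg : NonNeg D′
    borrow-nonneg i with ∈-++⁻ A (subst (i ∈_) ws≡ (enumeration-∈ enum))
    ... | inj₁ i∈A = subst (+ 0 ℤ.≤_) (sym (All.lookup borrowed-A i∈A)) (+≤+ z≤n)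
    ... | inj₂ i∈B = subst (+ 0 ℤ.≤_) (sym (All.lookup borrowed-B i∈B)) (+≤+ z≤n)

    private
      map-val-A : map (val D′) A ≡ map (_+ cost y) (map (val D) A)
      map-val-A = trans (map-cong-local (All.map (cong ℤ.∣_∣) borrowed-A)) (map-∘ A)

      map-val-B : map (val D′) B ≡ map (_∸ x) (map (val D) B)
      map-val-B = trans (map-cong-local (All.map (cong ℤ.∣_∣) borrowed-B)) (map-∘ B)

      reascend : ∀ {f : ℕ → ℕ} {xs} → (∀ {m n} → m ≤ n → f m ≤ f n) →
        map (val D′) xs ≡ map f (map (val D) xs) → Ascending D xs → Ascending D′ xs
      reascend mono eq asc =
        AllPairs.map⁻ (subst (AllPairs _≤_) (sym eq) (AllPairs.map⁺ (AllPairs.map mono (AllPairs.map⁺ asc))))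

    borrow-ascending : Ascending D′ (B ++ A)
    borrow-ascending = AllPairs.++⁺
      (reascend (∸-monoˡ-≤ x) map-val-B (proj₁ (proj₂ asc-split)))
      (reascend (+-monoˡ-≤ (cost y)) map-val-A (proj₁ asc-split))
      (All.tabulate λ u∈B → All.tabulate λ w∈A → begin
        val D′ _          ≡⟨ cong ℤ.∣_∣ (All.lookup borrowed-B u∈B) ⟩
        val D _ ∸ x       ≤⟨ ∸-monoˡ-≤ x (<⇒≤ (below-a _)) ⟩
        a ∸ x             ≡⟨ cong (_∸ x) x+cost≡a ⟨
        x + cost y ∸ x    ≡⟨ m+n∸m≡n x (cost y) ⟩
        cost y            ≤⟨ m≤n+m (cost y) (val D _) ⟩
        val D _ + cost y  ≡⟨ cong ℤ.∣_∣ (All.lookup borrowed-A w∈A) ⟨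
        val D′ _          ∎)
      where
      open ≤-Reasoning
      asc-split = AllPairs-++⁻ A (subst (Ascending D) ws≡ ascending)

    private
      L = level a b (x , y)
      XA = map (val D) A
      XB = map (val D) B

      levels-B : stairLevels a b 0 (map (_∸ x) XB) ≡ map (ℤ._- L) (stairLevels a b y XB)
      levels-B = begin
        stairLevels a b 0 (map (_∸ x) XB)
          ≡⟨ map-+-− L (stairLevels a b 0 (map (_∸ x) XB)) ⟨
        map (ℤ._- L) (map (ℤ._+ L) (stairLevels a b 0 (map (_∸ x) XB)))
          ≡⟨ cong (map (ℤ._- L)) (stairLevels-translate a b 0 x y (map (_∸ x) XB)) ⟨
        map (ℤ._- L) (stairLevels a b y (map (_+ x) (map (_∸ x) XB)))
          ≡⟨ cong (map (ℤ._- L) ∘ stairLevels a b y) restore ⟩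
        map (ℤ._- L) (stairLevels a b y XB)                               ∎
        where
        open ≡-Reasoning
        restore : map (_+ x) (map (_∸ x) XB) ≡ XB
        restore = trans (sym (map-∘ XB)) (map-id-local (All.map⁺ (All.map m∸n+n≡m x≤B)))

      levels-A : stairLevels a b (length B) (map (_+ cost y) XA) ≡ map (ℤ._- L) (stairLevels a b 0 XA)
      levels-A = trans (stairLevels-translate a b 0 (cost y) (length B) XA)
        (cong (λ c → map (ℤ._+ c) (stairLevels a b 0 XA)) (level-complement a b x+cost≡a y+B≡b))

    borrow-levels : stairLevels a b 0 (map (val D′) (B ++ A)) ≡ map (ℤ._- L) (rotate y (stairLevels a b 0 (map (val D) ws)))
    borrow-levels = begin
      stairLevels a b 0 (map (val D′) (B ++ A))
        ≡⟨ cong (stairLevels a b 0) (trans (map-++ (val D′) B A) (cong₂ _++_ map-val-B map-val-A)) ⟩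
      stairLevels a b 0 (map (_∸ x) XB ++ map (_+ cost y) XA)
        ≡⟨ stairLevels-++ a b 0 (map (_∸ x) XB) (map (_+ cost y) XA) ⟩
      stairLevels a b 0 (map (_∸ x) XB) ++ stairLevels a b (length (map (_∸ x) XB)) (map (_+ cost y) XA)
        ≡⟨ cong₂ _++_ levels-B (trans (cong (λ t → stairLevels a b t (map (_+ cost y) XA)) length-XB′) levels-A) ⟩
      map (ℤ._- L) (stairLevels a b y XB) ++ map (ℤ._- L) (stairLevels a b 0 XA)
        ≡⟨ map-++ (ℤ._- L) (stairLevels a b y XB) (stairLevels a b 0 XA) ⟨
      map (ℤ._- L) (stairLevels a b y XB ++ stairLevels a b 0 XA)
        ≡⟨ cong (map (ℤ._- L)) rotated ⟨
      map (ℤ._- L) (rotate y (stairLevels a b 0 (map (val D) ws))) ∎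
      where
      open ≡-Reasoning
      length-XB′ : length (map (_∸ x) XB) ≡ length B
      length-XB′ = trans (length-map (_∸ x) XB) (length-map (val D) B)
      length-levels-A : length (stairLevels a b 0 XA) ≡ y
      length-levels-A = trans (length-map (level a b) (stairs 0 XA)) (trans (length-stairs 0 XA) (length-map (val D) A))
      rotated : rotate y (stairLevels a b 0 (map (val D) ws)) ≡ stairLevels a b y XB ++ stairLevels a b 0 XA
      rotated = begin
        rotate y (stairLevels a b 0 (map (val D) ws))
          ≡⟨ cong (rotate y ∘ stairLevels a b 0) (trans (cong (map (val D)) ws≡) (map-++ (val D) A B)) ⟩
        rotate y (stairLevels a b 0 (XA ++ XB))
          ≡⟨ cong (rotate y) (stairLevels-++ a b 0 XA XB) ⟩
        rotate y (stairLevels a b 0 XA ++ stairLevels a b (length XA) XB)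
          ≡⟨ cong (λ t → rotate y (stairLevels a b 0 XA ++ stairLevels a b t XB)) (length-map (val D) A) ⟩
        rotate y (stairLevels a b 0 XA ++ stairLevels a b y XB)
          ≡⟨ cong (λ t → rotate t (stairLevels a b 0 XA ++ stairLevels a b y XB)) length-levels-A ⟨
        rotate (length (stairLevels a b 0 XA)) (stairLevels a b 0 XA ++ stairLevels a b y XB)
          ≡⟨ rotate-++ (stairLevels a b 0 XA) _ ⟩
        stairLevels a b y XB ++ stairLevels a b 0 XA
          ∎

    borrow-kStable⇔ : KStable a b k D′ ⇔ TailAbove k L (rotate y (stairLevels a b 0 (map (val D) ws)))
    borrow-kStable⇔ =
      ⇔-trans (kStable⇔tailLevels a b k borrow-nonneg (enumeration-swap A enumAB) borrow-ascending)
        (⇔-trans (≡⇒⇔ (cong (TailAbove k (+ 0)) borrow-levels))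
                 (tailAbove-shift⇔ k L (rotate y (stairLevels a b 0 (map (val D) ws)))))

-- Skeletal configurations and skeletal paths

module _ {a b k : ℕ} {Q : Path b} where

  R2⇔splitForm :
    (∀ m → m ≤ length Q → + 0 ℤ.< level a b (pointAt m Q) → ¬ R1 a b k (shift m Q)) ⇔
    (∀ U R → U ++ R ≡ Q → + 0 ℤ.< level a b (endpoint U) → ¬ R1 a b k (R ++ U))
  R2⇔splitForm = mk⇔ to from
    where
    to : (∀ m → m ≤ length Q → + 0 ℤ.< level a b (pointAt m Q) → ¬ R1 a b k (shift m Q)) →
         ∀ U R → U ++ R ≡ Q → + 0 ℤ.< level a b (endpoint U) → ¬ R1 a b k (R ++ U)
    to r2 U R refl pos r1 = r2 (length U) (subst (length U ≤_) (sym (length-++ U)) (m≤m+n _ _))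
      (subst (λ P → + 0 ℤ.< level a b (endpoint P)) (sym (take-length-++ U R)) pos)
      (subst (R1 a b k) (sym (cong₂ _++_ (drop-length-++ U R) (take-length-++ U R))) r1)
    from : (∀ U R → U ++ R ≡ Q → + 0 ℤ.< level a b (endpoint U) → ¬ R1 a b k (R ++ U)) →
           ∀ m → m ≤ length Q → + 0 ℤ.< level a b (pointAt m Q) → ¬ R1 a b k (shift m Q)
    from r2 m _ = r2 (take m Q) (drop m Q) (take++drop≡id m Q)

module _ (a b : ℕ) .{{_ : NonZero b}} where

  open Cost a b

  kStable⇒below-a : ∀ {k C} → 0 < a → KStable a b k C → ∀ i → val C i < a
  kStable⇒below-a {k} {C} 0<a (nn , stable) i = ≰⇒> λ a≤i →
    stable ⁅ i ⁆ (subst (0 <_) (sym (∣⁅x⁆∣≡1 i)) (s≤s z≤n))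
                 (subst (_≤ suc k) (sym (∣⁅x⁆∣≡1 i)) (s≤s z≤n))
      (Equivalence.from (fire-legal⇔ a b ⁅ i ⁆ nn) (costs a≤i))
    where
    costs : a ≤ val C i → ∀ j → lookup ⁅ i ⁆ j ≡ true → cost ∣ ⁅ i ⁆ ∣ ≤ val C j
    costs a≤i j j∈⁅i⁆ rewrite ∣⁅x⁆∣≡1 i | x∈⁅y⁆⇒x≡y i (lookup⇒[]= j ⁅ i ⁆ j∈⁅i⁆) =
      ≤-trans (proj₁ (cost-window 0<a (s≤s z≤n) (ℕ.>-nonZero⁻¹ b))) a≤i

  module Theorem (0<a : 0 < a) (coprime : Coprime a b) (k : ℕ) (D : Config b) (nn : NonNeg D) where

    private
      ws = sortedVerts D
      enum = sortedVerts-enumeration D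
      ascending = sortedVerts-ascending D nn
      levels = stairLevels a b 0 (map (val D) ws)
      Q = lpath a D
      0≤ws : All ((0 ≤_) ∘ val D) ws
      0≤ws = All.universal (λ _ → z≤n) ws

    lpath-levels : northLevels a b (0 , 0) Q ≡ levels
    lpath-levels = cong (map (level a b)) (northStarts-lpathFrom D a 0 0 ws 0≤ws ascending)

    lpath-R1⇔kStable : R1 a b k Q ⇔ KStable a b k D
    lpath-R1⇔kStable = ⇔-trans (R1⇔tailAbove a b k Q)
      (⇔-trans (≡⇒⇔ (cong (TailAbove k (+ 0)) lpath-levels)) (⇔-sym (kStable⇔tailLevels a b k nn enum ascending)))

    lpath-split⇒threshold : ∀ U R → U ++ R ≡ Q →
      ∃₂ λ A B → ThresholdSplit D (countE U) ws A B × length A ≡ countN U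
    lpath-split⇒threshold U R U++R≡Q =
      subst (λ P → ∃₂ λ A B → ThresholdSplit D (countE P) ws A B × length A ≡ countN P) take≡U
        (lpathFrom-point⇒split D a 0 ws (length U) 0≤ws ascending)
      where take≡U = trans (cong (take (length U)) (sym U++R≡Q)) (take-length-++ U R)

    threshold⇒lpath-split : ∀ {x A B} → ThresholdSplit D x ws A B → x ≤ a →
      ∃₂ λ U R → U ++ R ≡ Q × endpoint U ≡ (x , length A)
    threshold⇒lpath-split split x≤a with split⇒lpathFrom-point D a split 0≤ws ascending z≤n x≤a
    ... | m , point = take m Q , drop m Q , take++drop≡id m Q , point

    shiftLevels-lpath : ∀ U R → U ++ R ≡ Q → shiftLevels a b k U R ≡ rotate (countN U) levels
    shiftLevels-lpath U R U++R≡Q = begin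
      northLevels a b (endpoint U) R ++ northLevels a b (0 , 0) U
        ≡⟨ rotate-++ (northLevels a b (0 , 0) U) _ ⟨
      rotate (length (northLevels a b (0 , 0) U)) (northLevels a b (0 , 0) U ++ northLevels a b (endpoint U) R)
        ≡⟨ cong₂ rotate (trans (length-map (level a b) (northStarts (0 , 0) U)) (length-northStarts (0 , 0) U))
                        (sym (northLevels-++ a b 0 0 U R)) ⟩
      rotate (countN U) (northLevels a b (0 , 0) (U ++ R))
        ≡⟨ cong (rotate (countN U)) (trans (cong (northLevels a b (0 , 0)) U++R≡Q) lpath-levels) ⟩
      rotate (countN U) levels ∎
      where open ≡-Reasoning

    shiftR1⇔tailAbove : ∀ U R → U ++ R ≡ Q → ∀ {x y} → endpoint U ≡ (x , y) →
      ShiftR1 a b k U R ⇔ TailAbove k (level a b (x , y)) (rotate y levels)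
    shiftR1⇔tailAbove U R U++R≡Q refl = ≡⇒⇔ (cong (TailAbove k _) (shiftLevels-lpath U R U++R≡Q))

    module _ (stable : KStable a b k D) where

      private
        below-a = kStable⇒below-a 0<a stable

      lpath-countE : countE Q ≡ a
      lpath-countE = countE-lpathFrom D a 0 ws z≤n 0≤ws ascending (All.universal (<⇒≤ ∘ below-a) ws)

      lpath-countN : countN Q ≡ b
      lpath-countN = trans (countN-lpathFrom D a 0 ws) (enumeration-length ws enum)

      lpath-R1-shift⇔ : ∀ U R → U ++ R ≡ Q → R1 a b k (R ++ U) ⇔ ShiftR1 a b k U R
      lpath-R1-shift⇔ U R U++R≡Q =
        R1-shift⇔ a b U R (trans (sym (countE-++ U R)) (trans (cong countE U++R≡Q) lpath-countE))
                         (trans (sym (countN-++ U R)) (trans (cong countN U++R≡Q) lpath-countN)) k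

      borrow-shift : ∀ {T x y A B} → ws ≡ A ++ B → All (λ w → x ≤ val D w) B → length A ≡ y → 0 < y →
        x + cost y ≡ a → All (λ i → lookup T i ≡ true) A → All (λ i → lookup T i ≡ false) B →
        NonNeg (borrow a b T D) × (KStable a b k (borrow a b T D) ⇔ TailAbove k (level a b (x , y)) (rotate y levels))
      borrow-shift {T} ws≡ x≤B refl 0<y x+cost≡a inT outT = borrow-nonneg , borrow-kStable⇔
        where open BorrowShift a b coprime k nn enum ascending below-a {T} ws≡ x≤B 0<y x+cost≡a inT outT

      windowed-shiftR1⇒stable-borrow : ∀ U R → U ++ R ≡ Q → Window a b U → ShiftR1 a b k U R →
        ∃ λ T → 0 < ∣ T ∣ × NonNeg (borrow a b T D) × KStable a b k (borrow a b T D)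
      windowed-shiftR1⇒stable-borrow U R U++R≡Q (pos , ≤b) good with lpath-split⇒threshold U R U++R≡Q
      ... | A , B , split , lenA =
        setOf A , 0<∣T∣ , proj₁ borrowed ,
        Equivalence.from (proj₂ borrowed) (Equivalence.to (shiftR1⇔tailAbove U R U++R≡Q refl) good)
        where
        bx<ay : b * countE U < a * countN U
        bx<ay = Equivalence.to 0<m-n⇔n<m pos
        ay≤bx+b : a * countN U ≤ b * countE U + b
        ay≤bx+b = Equivalence.to m-n≤c⇔m≤n+c ≤b
        y≤b : countN U ≤ b
        y≤b = subst (countN U ≤_) (trans (sym (countN-++ U R)) (trans (cong countN U++R≡Q) lpath-countN)) (m≤m+n _ _)
        0<y : 0 < countN U
        0<y = n≢0⇒n>0 λ y≡0 → <⇒≱ bx<ay (≤-trans (≤-reflexive (trans (cong (a *_) y≡0) (*-zeroʳ a))) z≤n)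
        enumAB = subst IsEnumeration (proj₁ split) enum
        inT = proj₁ (setOf-split A enumAB)
        outT = proj₂ (setOf-split A enumAB)
        borrowed = borrow-shift {setOf A} (proj₁ split) (proj₂ (proj₂ split)) lenA 0<y
                     (window⇒+cost bx<ay ay≤bx+b y≤b) inT outT
        0<∣T∣ : 0 < ∣ setOf A ∣
        0<∣T∣ = subst (0 <_) (sym (trans (count-split (setOf A) A enumAB inT outT) lenA)) 0<y

      module _ (T : Subset b) (0<y : 0 < ∣ T ∣) (nonneg′ : NonNeg (borrow a b T D))
               (stable′ : KStable a b k (borrow a b T D)) where

        private
          y = ∣ T ∣
          x = a ∸ cost y
          window = cost-window 0<a 0<y (∣p∣≤n T)
          x+cost≡a : x + cost y ≡ a
          x+cost≡a = m∸n+n≡m (proj₁ window)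

        inside⇒below : ∀ {i} → lookup T i ≡ true → val D i < x
        inside⇒below {i} i∈T = +-cancelʳ-< (cost y) (val D i) x (begin-strict
          val D i + cost y               ≡⟨ cong ℤ.∣_∣ (borrow-inside a b nn T i∈T) ⟨
          val (borrow a b T D) i         <⟨ kStable⇒below-a 0<a stable′ i ⟩
          a                              ≡⟨ x+cost≡a ⟨
          x + cost y                     ∎)
          where open ≤-Reasoning

        outside⇒above : ∀ {i} → lookup T i ≡ false → x ≤ val D i
        outside⇒above {i} i∉T = ≤-trans x≤gain (Equivalence.to 0≤m-n⇔n≤m
          (subst (+ 0 ℤ.≤_) (borrow-outside a b nn T i∉T) (nonneg′ i)))
          where
          x≤gain : x ≤ (y * a) / b
          x≤gain with y <? b
          ... | yes y<b =
            ≤-reflexive (+-cancelʳ-≡ (cost y) x _ (trans x+cost≡a (sym (coprime⇒gain+cost coprime 0<y y<b))))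
          ... | no y≮b = begin
            a ∸ cost y      ≤⟨ m∸n≤m a (cost y) ⟩
            a               ≡⟨ m*n/n≡m a b ⟨
            (a * b) / b     ≡⟨ cong (_/ b) (*-comm a b) ⟩
            (b * a) / b     ≡⟨ cong (λ s → (s * a) / b) (≤-antisym (≮⇒≥ y≮b) (∣p∣≤n T)) ⟩
            (y * a) / b     ∎
            where open ≤-Reasoning

        below⇒inside : ∀ {i} → val D i < x → lookup T i ≡ true
        below⇒inside {i} i<x with lookup T i in eq
        ... | true = refl
        ... | false = contradiction (outside⇒above eq) (<⇒≱ i<x)

        above⇒outside : ∀ {i} → x ≤ val D i → lookup T i ≡ false
        above⇒outside {i} x≤i with lookup T i in eq
        ... | false = refl
        ... | true = contradiction (inside⇒below eq) (≤⇒≯ x≤i)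

        stable-borrow⇒shiftR1 : ∃₂ λ U R → U ++ R ≡ Q × + 0 ℤ.< level a b (endpoint U) × ShiftR1 a b k U R
        stable-borrow⇒shiftR1 with threshold-split D x ws ascending
        ... | A , B , ws≡ , A<x , x≤B
          with threshold⇒lpath-split (ws≡ , All.map <⇒≤ A<x , x≤B) (m∸n≤m a (cost y))
        ...   | U , R , U++R≡Q , point = U , R , U++R≡Q , pos , good
          where
          inT = All.map below⇒inside A<x
          outT = All.map above⇒outside x≤B
          lenA : length A ≡ y
          lenA = sym (count-split T A (subst IsEnumeration ws≡ enum) inT outT)
          endpoint≡ : endpoint U ≡ (x , y)
          endpoint≡ = trans point (cong (x ,_) lenA)
          pos : + 0 ℤ.< level a b (endpoint U)
          pos = subst (λ p → + 0 ℤ.< level a b p) (sym endpoint≡) (Equivalence.from 0<m-n⇔n<m (proj₁ (proj₂ window)))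
          good : ShiftR1 a b k U R
          good = Equivalence.from (shiftR1⇔tailAbove U R U++R≡Q endpoint≡)
            (Equivalence.to (proj₂ (borrow-shift {T} ws≡ x≤B lenA 0<y x+cost≡a inT outT)) stable′)

    skeletal⇒path : KSkeletal a b k D → KSkeletalPath a b k Q
    skeletal⇒path (stable , skeletal) =
      (lpath-countE stable , lpath-countN stable) , Equivalence.from lpath-R1⇔kStable stable ,
      Equivalence.from (R2⇔splitForm {a} {b} {k}) λ U R U++R≡Q pos r1 →
        let (U′ , R′ , U′++R′≡Q , window , good) =
              shiftR1⇒windowed a b k Q (lpath-countE stable) (lpath-countN stable) U R U++R≡Q pos
                (Equivalence.to (lpath-R1-shift⇔ stable U R U++R≡Q) r1)
            (T , 0<∣T∣ , nonneg′ , stable′) =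
              windowed-shiftR1⇒stable-borrow stable U′ R′ U′++R′≡Q window good
        in skeletal T 0<∣T∣ nonneg′ stable′

    path⇒skeletal : KSkeletalPath a b k Q → KSkeletal a b k D
    path⇒skeletal (_ , r1 , r2) = stable , λ T 0<∣T∣ nonneg′ stable′ →
      let (U , R , U++R≡Q , pos , good) = stable-borrow⇒shiftR1 stable T 0<∣T∣ nonneg′ stable′
      in Equivalence.to (R2⇔splitForm {a} {b} {k}) r2 U R U++R≡Q pos
           (Equivalence.from (lpath-R1-shift⇔ stable U R U++R≡Q) good)
      where stable = Equivalence.to lpath-R1⇔kStable r1

theorem4p1 : (a b : ℕ) .{{_ : NonZero b}} → 0 < a → Coprime a b →
    (k : ℕ) → k < b → (D : Config b) → NonNeg D →
    KSkeletal a b k D ⇔ KSkeletalPath a b k (lpath a D)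
theorem4p1 a b 0<a coprime k _ D nn = mk⇔ skeletal⇒path path⇒skeletal
  where open Theorem a b 0<a coprime k D nn
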